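{- Let $a_1,a_2,a_3,b_1,b_2,b_3$ be integers with $b_1\le\min\{a_1,a_2,a_3\}$, $\max\{a_1,a_2,a_3\}<\min\{b_2,b_3\}$, and $a_1+a_2+a_3\le b_1+b_2+b_3-2$. Define $$R(t)=\frac{(b_2-a_2-1)!\,(b_3-a_3-1)!}{(a_1-b_1)!}\cdot\frac{\Gamma(t+a_1)\Gamma(t+a_2)\Gamma(t+a_3)}{\Gamma(t+b_1)\Gamma(t+b_2)\Gamma(t+b_3)}$$ and $G(\boldsymbol a,\boldsymbol b)=\sum_{t=t_0}^\infty R(t)$, where $t_0$ is any integer with $1-\min\{a_1,a_2,a_3\}\le t_0\le 1-b_1$. Let $a_1^*\le a_2^*\le a_3^*$ be $a_1,a_2,a_3$ in non-decreasing order and $b_2^*=\min\{b_2,b_3\}$, $b_3^*=\max\{b_2,b_3\}$. Then $G(\boldsymbol a,\boldsymbol b)=A\zeta(2)-B$ with rational $A,B$ such that $A\in\mathbb Z$ and $$D_{b_3^*-a_1^*-1}\cdot D_{\max\{a_1-b_1,\;b_3^*-a_2-1,\;b_3^*-a_3-1,\;b_2^*-a_1^*-1\}}\cdot B\in\mathbb Z.$$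
   Context: $D_N$ denotes the least common multiple of $1,2,\dots,N$ (with $D_0=1$). $\zeta$ is the Riemann zeta function. -}

module Defs where

open import Data.Nat using (ℕ; zero; suc)
import Data.Nat as ℕ
open import Data.Nat using (_!)
open import Data.Nat.LCM using (lcm)
open import Data.Integer using (ℤ; +_; -[1+_]; ∣_∣)
import Data.Integer as ℤ
open import Data.Rational using (ℚ; mkℚ; 0ℚ; 1ℚ; 1/_; _+_; _*_; _/_)
import Data.Rational as ℚ

fromℤ : ℤ → ℚ
fromℤ z = z / 1

D : ℕ → ℕ
D zero = 1
D (suc n) = lcm (suc n) (D n)

-- total reciprocal on ℚ (1/0 := 0); only ever applied to nonzero values below
inv : ℚ → ℚ
inv (mkℚ (+ zero) _ _) = 0ℚ
inv p@(mkℚ (+ suc _) _ _) = 1/ p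
inv p@(mkℚ -[1+ _ ] _ _) = 1/ p

poch : ℤ → ℕ → ℚ
poch x zero = 1ℚ
poch x (suc k) = fromℤ x * poch (x ℤ.+ + 1) k

-- the integer n ≥ 0 as a natural number (truncation; only used on nonnegative values)
toℕ : ℤ → ℕ
toℕ z = ∣ z ∣

facℚ : ℤ → ℚ
facℚ z = fromℤ (+ (toℕ z !))

-- R(t) for integer t with t + a_i ≥ 1.  Using Γ(x+k)/Γ(x) = x(x+1)...(x+k-1):
--   Γ(t+a1)/Γ(t+b1) = poch (t+b1) (a1-b1)   (a1 ≥ b1; equals 0 when t+b1 ≤ 0, i.e. 1/Γ pole)
--   Γ(t+a_j)/Γ(t+b_j) = 1 / poch (t+a_j) (b_j-a_j)   (j = 2,3; b_j > a_j, t+a_j ≥ 1)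
R : (a₁ a₂ a₃ b₁ b₂ b₃ : ℤ) → ℤ → ℚ
R a₁ a₂ a₃ b₁ b₂ b₃ t =
  ((facℚ (b₂ ℤ.- a₂ ℤ.- + 1) * facℚ (b₃ ℤ.- a₃ ℤ.- + 1)) * inv (fromℤ (+ (toℕ (a₁ ℤ.- b₁) !))))
  * (poch (t ℤ.+ b₁) (toℕ (a₁ ℤ.- b₁))
     * (inv (poch (t ℤ.+ a₂) (toℕ (b₂ ℤ.- a₂))) * inv (poch (t ℤ.+ a₃) (toℕ (b₃ ℤ.- a₃)))))

sumℚ : ℕ → (ℕ → ℚ) → ℚ
sumℚ zero f = 0ℚ
sumℚ (suc n) f = sumℚ n f + f n

Gpartial : (a₁ a₂ a₃ b₁ b₂ b₃ t₀ : ℤ) → ℕ → ℚ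
Gpartial a₁ a₂ a₃ b₁ b₂ b₃ t₀ N = sumℚ N (λ k → R a₁ a₂ a₃ b₁ b₂ b₃ (t₀ ℤ.+ + k))

ζ2partial : ℕ → ℚ
ζ2partial N = sumℚ N (λ k → inv (fromℤ (+ (suc k ℕ.* suc k))))

ConvergesTo : (ℕ → ℚ) → ℚ → Set
ConvergesTo s L = ∀ (ε : ℚ) → 0ℚ ℚ.< ε →
  Σ' ℕ (λ M → ∀ N → M ℕ.≤ N → ℚ.∣ s N ℚ.- L ∣ ℚ.< ε)
  where open import Data.Product using () renaming (Σ to Σ')

{-# OPTIONS --safe #-}
module Submission where

-- Write R(t) = (t+b₁)ₙ₁/n₁! · n₂!/(t+a₂)ₙ₂₊₁ · n₃!/(t+a₃)ₙ₃₊₁ with n₁ = a₁-b₁ and nⱼ = bⱼ-aⱼ-1.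
-- Each factor n!/(x)ₙ₊₁ = Σⱼ (-1)ʲ (n choose j)/(x+j) has integer partial fractions; their product
-- splits into terms β/(t+k) and α/(t+k)², and the numerator (t+b₁)ₙ₁ is then multiplied in one linear
-- factor at a time, each step producing a constant.  Because R has degree at most -2 these constants
-- add up to zero at every stage (a rational number bounded by C/N for all N vanishes), so
-- R(t) = Σ βₖ/(t+k) + Σ αₖ/(t+k)² with Σ βₖ = 0.  Summing over t ≥ t₀, the simple terms telescope to
-- harmonic numbers and the double ones to tails of ζ(2): G = A ζ(2) - B with A = Σ αₖ and
-- B = Σ (αₖ H₂(mₖ) + βₖ H₁(mₖ)), mₖ the offset of the pole k from the start of the summation.
-- The coefficients are controlled by (x)ᵢ/i! ∈ ℤ and D_{i+j+1} i! j!/(i+j+1)! ∈ ℤ, so A ∈ ℤ and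
-- D_M βₖ ∈ ℤ, while D_X H₁(mₖ) ∈ ℤ and D_m² H₂(m) ∈ ℤ for the offsets that occur.

module Proof where

  open import Defs
  open import Data.Nat as ℕ using (ℕ; zero; suc; _!; _^_; z≤n; s≤s)
  import Data.Nat.Properties as ℕₚ
  open import Data.Nat.Induction using (<-rec)
  import Data.Nat.Tactic.RingSolver as ℕ-Solver
  open import Data.Nat.Divisibility as ℕ∣ using (_∣_; divides)
  open import Data.Nat.LCM using (m∣lcm[m,n]; n∣lcm[m,n])
  open import Data.Nat.Combinatorics using (k![n∸k]!∣n!)
  open import Data.Nat.Coprimality using (1-coprimeTo)
  import Data.Nat.Coprimality as Coprime
  open import Data.Integer as ℤ using (ℤ; +_; -[1+_]; _⊓_; _⊔_)
  import Data.Integer.Properties as ℤₚ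
  import Data.Integer.Tactic.RingSolver as ℤ-Solver
  open import Data.Rational as ℚ using (ℚ; mkℚ; 0ℚ; 1ℚ; _+_; _*_; _-_; -_; _≤_; _<_; ∣_∣)
  open import Data.Rational.Base using (*≤*; *<*; nonNegative; positive)
  import Data.Rational.Properties as ℚₚ
  open import Data.Rational.Solver using (module +-*-Solver)
  open +-*-Solver using (solve; _:+_; _:*_; _:-_; :-_; _:=_; con)
  open import Data.List using (List; []; _∷_; _++_; map)
  open import Data.List.Relation.Unary.All as All using (All; []; _∷_)
  import Data.List.Relation.Unary.All.Properties as Allₚ
  open import Data.Product using (Σ; _,_; proj₁; proj₂; _×_)
  open import Data.Sum using (_⊎_; inj₁; inj₂)
  open import Data.Empty using (⊥-elim)
  open import Relation.Nullary using (yes; no; ¬_; Dec)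
  open import Relation.Binary.Definitions using (tri<; tri≈; tri>)
  open import Relation.Binary.PropositionalEquality

  fromℤ≡mkℚ : ∀ z → fromℤ z ≡ mkℚ z 0 (Coprime.sym (1-coprimeTo ℤ.∣ z ∣))
  fromℤ≡mkℚ z = ℚₚ.↥p/↧p≡p (mkℚ z 0 _)

  fromℤ-+ : ∀ a b → fromℤ (a ℤ.+ b) ≡ fromℤ a + fromℤ b
  fromℤ-+ a b = trans (cong (ℚ._/ 1) (cong₂ ℤ._+_ (sym (ℤₚ.*-identityʳ a)) (sym (ℤₚ.*-identityʳ b))))
                      (sym (cong₂ _+_ (fromℤ≡mkℚ a) (fromℤ≡mkℚ b)))

  fromℤ-* : ∀ a b → fromℤ (a ℤ.* b) ≡ fromℤ a * fromℤ b
  fromℤ-* a b = sym (cong₂ _*_ (fromℤ≡mkℚ a) (fromℤ≡mkℚ b))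

  fromℤ-neg : ∀ a → fromℤ (ℤ.- a) ≡ - fromℤ a
  fromℤ-neg a = trans (fromℤ≡mkℚ (ℤ.- a)) (trans (neg-mkℚ a) (cong -_ (sym (fromℤ≡mkℚ a))))
    where
    neg-mkℚ : ∀ a → mkℚ (ℤ.- a) 0 (Coprime.sym (1-coprimeTo ℤ.∣ ℤ.- a ∣))
                  ≡ - mkℚ a 0 (Coprime.sym (1-coprimeTo ℤ.∣ a ∣))
    neg-mkℚ (+ zero)  = refl
    neg-mkℚ (+ suc n) = refl
    neg-mkℚ -[1+ n ]  = refl

  fromℤ-sub : ∀ a b → fromℤ (a ℤ.- b) ≡ fromℤ a - fromℤ b
  fromℤ-sub a b = trans (fromℤ-+ a (ℤ.- b)) (cong (_+_ (fromℤ a)) (fromℤ-neg b))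

  fromℤ-pos-* : ∀ m n → fromℤ (+ (m ℕ.* n)) ≡ fromℤ (+ m) * fromℤ (+ n)
  fromℤ-pos-* m n = trans (cong fromℤ (ℤₚ.pos-* m n)) (fromℤ-* (+ m) (+ n))

  fromℤ-injective : ∀ {a b} → fromℤ a ≡ fromℤ b → a ≡ b
  fromℤ-injective {a} {b} eq = cong ℚ.↥_ (trans (sym (fromℤ≡mkℚ a)) (trans eq (fromℤ≡mkℚ b)))

  fromℤ-mono-≤ : ∀ {m n} → m ℤ.≤ n → fromℤ m ≤ fromℤ n
  fromℤ-mono-≤ {m} {n} m≤n = subst₂ _≤_ (sym (fromℤ≡mkℚ m)) (sym (fromℤ≡mkℚ n))
    (*≤* (subst₂ ℤ._≤_ (sym (ℤₚ.*-identityʳ m)) (sym (ℤₚ.*-identityʳ n)) m≤n))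

  fromℤ-mono-< : ∀ {m n} → m ℤ.< n → fromℤ m < fromℤ n
  fromℤ-mono-< {m} {n} m<n = subst₂ _<_ (sym (fromℤ≡mkℚ m)) (sym (fromℤ≡mkℚ n))
    (*<* (subst₂ ℤ._<_ (sym (ℤₚ.*-identityʳ m)) (sym (ℤₚ.*-identityʳ n)) m<n))

  fromℤ-nonNeg : ∀ n → 0ℚ ≤ fromℤ (+ n)
  fromℤ-nonNeg n = fromℤ-mono-≤ {+ 0} {+ n} (ℤ.+≤+ z≤n)

  1≤⇒≢0 : ∀ {x} → + 1 ℤ.≤ x → x ≢ + 0
  1≤⇒≢0 (ℤ.+≤+ (s≤s _)) ()

  inv-inverseʳ : ∀ p → p ≢ 0ℚ → p * inv p ≡ 1ℚ
  inv-inverseʳ p@(mkℚ (+ zero) _ _)  p≢0 = ⊥-elim (p≢0 (ℚₚ.↥p≡0⇒p≡0 p refl))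
  inv-inverseʳ p@(mkℚ (+ suc n) _ _) p≢0 = ℚₚ.*-inverseʳ p
  inv-inverseʳ p@(mkℚ -[1+ n ] _ _)  p≢0 = ℚₚ.*-inverseʳ p

  inv-unique : ∀ p q → p * q ≡ 1ℚ → inv p ≡ q
  inv-unique p q pq≡1 with p ℚₚ.≟ 0ℚ
  ... | yes refl = ⊥-elim (0≢1 (trans (sym (ℚₚ.*-zeroˡ q)) pq≡1))
    where
    0≢1 : 0ℚ ≢ 1ℚ
    0≢1 ()
  ... | no p≢0 = begin
    inv p             ≡⟨ sym (ℚₚ.*-identityʳ (inv p)) ⟩
    inv p * 1ℚ        ≡⟨ cong (inv p *_) (sym pq≡1) ⟩
    inv p * (p * q)   ≡⟨ sym (ℚₚ.*-assoc (inv p) p q) ⟩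
    (inv p * p) * q   ≡⟨ cong (_* q) (trans (ℚₚ.*-comm (inv p) p) (inv-inverseʳ p p≢0)) ⟩
    1ℚ * q            ≡⟨ ℚₚ.*-identityˡ q ⟩
    q                 ∎
    where open ≡-Reasoning

  inv-* : ∀ p q → inv (p * q) ≡ inv p * inv q
  inv-* p q with p ℚₚ.≟ 0ℚ | q ℚₚ.≟ 0ℚ
  ... | yes refl | _        = trans (cong inv (ℚₚ.*-zeroˡ q)) (sym (ℚₚ.*-zeroˡ (inv q)))
  ... | no _     | yes refl = trans (cong inv (ℚₚ.*-zeroʳ p)) (sym (ℚₚ.*-zeroʳ (inv p)))
  ... | no p≢0   | no q≢0   = inv-unique (p * q) (inv p * inv q) (begin
    (p * q) * (inv p * inv q)   ≡⟨ solve 4 (λ p q i j → (p :* q) :* (i :* j) := (p :* i) :* (q :* j)) refl p q (inv p) (inv q) ⟩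
    (p * inv p) * (q * inv q)   ≡⟨ cong₂ _*_ (inv-inverseʳ p p≢0) (inv-inverseʳ q q≢0) ⟩
    1ℚ                          ∎)
    where open ≡-Reasoning

  inv-neg : ∀ p → inv (- p) ≡ - inv p
  inv-neg p = begin
    inv (- p)            ≡⟨ cong inv (solve 1 (λ p → :- p := (:- con 1ℚ) :* p) refl p) ⟩
    inv ((- 1ℚ) * p)     ≡⟨ inv-* (- 1ℚ) p ⟩
    (- 1ℚ) * inv p       ≡⟨ solve 1 (λ i → (:- con 1ℚ) :* i := :- i) refl (inv p) ⟩
    - inv p              ∎
    where open ≡-Reasoning

  fromℤ-inverseʳ : ∀ {x} → x ≢ + 0 → fromℤ x * inv (fromℤ x) ≡ 1ℚ
  fromℤ-inverseʳ x≢0 = inv-inverseʳ _ (λ eq → x≢0 (fromℤ-injective eq))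

  IsInt : ℚ → Set
  IsInt q = Σ ℤ λ z → fromℤ z ≡ q

  IsInt-fromℤ : ∀ z → IsInt (fromℤ z)
  IsInt-fromℤ z = z , refl

  IsInt-+ : ∀ {p q} → IsInt p → IsInt q → IsInt (p + q)
  IsInt-+ (a , refl) (b , refl) = a ℤ.+ b , fromℤ-+ a b

  IsInt-* : ∀ {p q} → IsInt p → IsInt q → IsInt (p * q)
  IsInt-* (a , refl) (b , refl) = a ℤ.* b , fromℤ-* a b

  IsInt-neg : ∀ {p} → IsInt p → IsInt (- p)
  IsInt-neg (a , refl) = ℤ.- a , fromℤ-neg a

  pochℤ : ℤ → ℕ → ℤ
  pochℤ x zero    = + 1
  pochℤ x (suc k) = x ℤ.* pochℤ (x ℤ.+ + 1) k

  poch≡fromℤ-pochℤ : ∀ x k → poch x k ≡ fromℤ (pochℤ x k)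
  poch≡fromℤ-pochℤ x zero    = refl
  poch≡fromℤ-pochℤ x (suc k) =
    trans (cong (fromℤ x *_) (poch≡fromℤ-pochℤ (x ℤ.+ + 1) k)) (sym (fromℤ-* x _))

  +1+≡+suc : ∀ x k → (x ℤ.+ + 1) ℤ.+ + k ≡ x ℤ.+ + suc k
  +1+≡+suc x k = trans (ℤₚ.+-assoc x (+ 1) (+ k)) (cong (ℤ._+_ x) (sym (ℤₚ.pos-+ 1 k)))

  pochℤ-suc : ∀ x k → pochℤ x (suc k) ≡ pochℤ x k ℤ.* (x ℤ.+ + k)
  pochℤ-suc x zero    = trans (ℤₚ.*-identityʳ x) (sym (trans (ℤₚ.*-identityˡ _) (ℤₚ.+-identityʳ x)))
  pochℤ-suc x (suc k) = begin
    x ℤ.* pochℤ (x ℤ.+ + 1) (suc k)                          ≡⟨ cong (x ℤ.*_) (pochℤ-suc (x ℤ.+ + 1) k) ⟩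
    x ℤ.* (pochℤ (x ℤ.+ + 1) k ℤ.* ((x ℤ.+ + 1) ℤ.+ + k))   ≡⟨ cong (λ w → x ℤ.* (pochℤ (x ℤ.+ + 1) k ℤ.* w)) (+1+≡+suc x k) ⟩
    x ℤ.* (pochℤ (x ℤ.+ + 1) k ℤ.* (x ℤ.+ + suc k))         ≡⟨ sym (ℤₚ.*-assoc x _ _) ⟩
    x ℤ.* pochℤ (x ℤ.+ + 1) k ℤ.* (x ℤ.+ + suc k)           ∎
    where open ≡-Reasoning

  poch-suc : ∀ x k → poch x (suc k) ≡ poch x k * fromℤ (x ℤ.+ + k)
  poch-suc x k = begin
    poch x (suc k)                          ≡⟨ poch≡fromℤ-pochℤ x (suc k) ⟩
    fromℤ (pochℤ x (suc k))                 ≡⟨ cong fromℤ (pochℤ-suc x k) ⟩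
    fromℤ (pochℤ x k ℤ.* (x ℤ.+ + k))       ≡⟨ fromℤ-* (pochℤ x k) _ ⟩
    fromℤ (pochℤ x k) * fromℤ (x ℤ.+ + k)   ≡⟨ cong (_* fromℤ (x ℤ.+ + k)) (sym (poch≡fromℤ-pochℤ x k)) ⟩
    poch x k * fromℤ (x ℤ.+ + k)            ∎
    where open ≡-Reasoning

  pochℕ : ℕ → ℕ → ℕ
  pochℕ x zero    = 1
  pochℕ x (suc k) = x ℕ.* pochℕ (suc x) k

  pochℤ-pos : ∀ x k → pochℤ (+ x) k ≡ + pochℕ x k
  pochℤ-pos x zero    = refl
  pochℤ-pos x (suc k) = begin
    + x ℤ.* pochℤ (+ x ℤ.+ + 1) k   ≡⟨ cong (λ w → + x ℤ.* pochℤ w k) (sym (ℤₚ.pos-+ x 1)) ⟩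
    + x ℤ.* pochℤ (+ (x ℕ.+ 1)) k   ≡⟨ cong (λ w → + x ℤ.* pochℤ (+ w) k) (ℕₚ.+-comm x 1) ⟩
    + x ℤ.* pochℤ (+ suc x) k       ≡⟨ cong (+ x ℤ.*_) (pochℤ-pos (suc x) k) ⟩
    + x ℤ.* + pochℕ (suc x) k       ≡⟨ sym (ℤₚ.pos-* x _) ⟩
    + pochℕ x (suc k)               ∎
    where open ≡-Reasoning

  ^≤pochℕ : ∀ {u x} k → u ℕ.≤ x → u ^ k ℕ.≤ pochℕ x k
  ^≤pochℕ zero    u≤x = s≤s z≤n
  ^≤pochℕ (suc k) u≤x = ℕₚ.*-mono-≤ u≤x (^≤pochℕ k (ℕₚ.m≤n⇒m≤1+n u≤x))

  pochℕ*!≡! : ∀ m k → pochℕ (suc m) k ℕ.* m ! ≡ (m ℕ.+ k) !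
  pochℕ*!≡! m zero    = trans (ℕₚ.+-identityʳ (m !)) (cong _! (sym (ℕₚ.+-identityʳ m)))
  pochℕ*!≡! m (suc k) = begin
    suc m ℕ.* pochℕ (suc (suc m)) k ℕ.* m !   ≡⟨ swap (suc m) (pochℕ (suc (suc m)) k) (m !) ⟩
    pochℕ (suc (suc m)) k ℕ.* (suc m ℕ.* m !) ≡⟨ pochℕ*!≡! (suc m) k ⟩
    (suc m ℕ.+ k) !                           ≡⟨ cong _! (sym (ℕₚ.+-suc m k)) ⟩
    (m ℕ.+ suc k) !                           ∎
    where
    open ≡-Reasoning
    swap : ∀ a b c → a ℕ.* b ℕ.* c ≡ b ℕ.* (a ℕ.* c)
    swap = ℕ-Solver.solve-∀

  k!∣pochℕ : ∀ m k → k ! ∣ pochℕ (suc m) k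
  k!∣pochℕ m k = divides q (ℕₚ.*-cancelʳ-≡ (pochℕ (suc m) k) (q ℕ.* k !) (m !) {{m ℕₚ.!≢0}} (begin
    pochℕ (suc m) k ℕ.* m !   ≡⟨ pochℕ*!≡! m k ⟩
    (m ℕ.+ k) !               ≡⟨ ℕ∣._∣_.equality k!m!∣[m+k]! ⟩
    q ℕ.* (k ! ℕ.* m !)       ≡⟨ sym (ℕₚ.*-assoc q (k !) (m !)) ⟩
    q ℕ.* k ! ℕ.* m !         ∎))
    where
    open ≡-Reasoning
    k!m!∣[m+k]! : k ! ℕ.* m ! ∣ (m ℕ.+ k) !
    k!m!∣[m+k]! = subst (λ w → k ! ℕ.* w ! ∣ (m ℕ.+ k) !) (ℕₚ.m+n∸n≡m m k) (k![n∸k]!∣n! (ℕₚ.m≤n+m k m))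
    q = ℕ∣.quotient k!m!∣[m+k]!

  pochℤ-zero : ∀ x k → x ℤ.≤ + 0 → + 1 ℤ.≤ x ℤ.+ + k → pochℤ x k ≡ + 0
  pochℤ-zero x zero x≤0 1≤x+0 =
    ⊥-elim (1≰0 (ℤₚ.≤-trans (subst (+ 1 ℤ.≤_) (ℤₚ.+-identityʳ x) 1≤x+0) x≤0))
    where
    1≰0 : ¬ (+ 1 ℤ.≤ + 0)
    1≰0 (ℤ.+≤+ ())
  pochℤ-zero (+ zero)   (suc k) x≤0 _ = refl
  pochℤ-zero (+ suc n)  (suc k) (ℤ.+≤+ ()) _
  pochℤ-zero -[1+ m ]   (suc k) x≤0 1≤x+k = begin
    -[1+ m ] ℤ.* pochℤ (-[1+ m ] ℤ.+ + 1) k   ≡⟨ cong (-[1+ m ] ℤ.*_) (pochℤ-zero _ k x+1≤0 1≤x+1+k) ⟩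
    -[1+ m ] ℤ.* + 0                          ≡⟨ ℤₚ.*-zeroʳ -[1+ m ] ⟩
    + 0                                       ∎
    where
    open ≡-Reasoning
    x+1≤0 : -[1+ m ] ℤ.+ + 1 ℤ.≤ + 0
    x+1≤0 = subst (ℤ._≤ + 0) (ℤₚ.+-comm (+ 1) -[1+ m ]) (ℤₚ.i<j⇒suc[i]≤j { -[1+ m ]} {+ 0} ℤ.-<+)
    1≤x+1+k : + 1 ℤ.≤ (-[1+ m ] ℤ.+ + 1) ℤ.+ + k
    1≤x+1+k = subst (+ 1 ℤ.≤_) (sym (+1+≡+suc -[1+ m ] k)) 1≤x+k

  pochℤ-reflect : ∀ x k → pochℤ x k ≡ (ℤ.-1ℤ ℤ.^ k) ℤ.* pochℤ ((+ 1 ℤ.- x) ℤ.- + k) k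
  pochℤ-reflect x zero    = refl
  pochℤ-reflect x (suc k) = begin
    x ℤ.* pochℤ (x ℤ.+ + 1) k                                   ≡⟨ cong (x ℤ.*_) (pochℤ-reflect (x ℤ.+ + 1) k) ⟩
    x ℤ.* (s ℤ.* pochℤ ((+ 1 ℤ.- (x ℤ.+ + 1)) ℤ.- + k) k)       ≡⟨ cong (λ w → x ℤ.* (s ℤ.* pochℤ w k)) shift ⟩
    x ℤ.* (s ℤ.* pochℤ y k)                                     ≡⟨ regroup x s (pochℤ y k) ⟩
    (ℤ.- s) ℤ.* (pochℤ y k ℤ.* (ℤ.- x))                          ≡⟨ cong (λ w → (ℤ.- s) ℤ.* (pochℤ y k ℤ.* w)) -x≡y+k ⟩
    (ℤ.- s) ℤ.* (pochℤ y k ℤ.* (y ℤ.+ + k))                      ≡⟨ cong₂ ℤ._*_ (sym (ℤₚ.-1*i≡-i s)) (sym (pochℤ-suc y k)) ⟩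
    (ℤ.-1ℤ ℤ.* s) ℤ.* pochℤ y (suc k)                            ∎
    where
    open ≡-Reasoning
    s = ℤ.-1ℤ ℤ.^ k
    y = (+ 1 ℤ.- x) ℤ.- + suc k
    regroup : ∀ x s p → x ℤ.* (s ℤ.* p) ≡ (ℤ.- s) ℤ.* (p ℤ.* (ℤ.- x))
    regroup = ℤ-Solver.solve-∀
    shift-ℤ : ∀ x k → (+ 1 ℤ.- (x ℤ.+ + 1)) ℤ.- k ≡ (+ 1 ℤ.- x) ℤ.- (+ 1 ℤ.+ k)
    shift-ℤ = ℤ-Solver.solve-∀
    shift : (+ 1 ℤ.- (x ℤ.+ + 1)) ℤ.- + k ≡ y
    shift = trans (shift-ℤ x (+ k)) (cong (λ w → (+ 1 ℤ.- x) ℤ.- w) (sym (ℤₚ.pos-+ 1 k)))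
    -x≡y+k-ℤ : ∀ x k → ℤ.- x ≡ ((+ 1 ℤ.- x) ℤ.- (+ 1 ℤ.+ k)) ℤ.+ k
    -x≡y+k-ℤ = ℤ-Solver.solve-∀
    -x≡y+k : ℤ.- x ≡ y ℤ.+ + k
    -x≡y+k = trans (-x≡y+k-ℤ x (+ k)) (cong (λ w → ((+ 1 ℤ.- x) ℤ.- w) ℤ.+ + k) (sym (ℤₚ.pos-+ 1 k)))

  pochℤ-pos-suc≡*! : ∀ m k → pochℤ (+ suc m) k ≡ + ℕ∣.quotient (k!∣pochℕ m k) ℤ.* + (k !)
  pochℤ-pos-suc≡*! m k = begin
    pochℤ (+ suc m) k      ≡⟨ pochℤ-pos (suc m) k ⟩
    + pochℕ (suc m) k      ≡⟨ cong +_ (ℕ∣._∣_.equality (k!∣pochℕ m k)) ⟩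
    + (q ℕ.* k !)          ≡⟨ ℤₚ.pos-* q (k !) ⟩
    + q ℤ.* + (k !)        ∎
    where
    open ≡-Reasoning
    q = ℕ∣.quotient (k!∣pochℕ m k)

  k!∣pochℤ : ∀ x k → Σ ℤ λ q → pochℤ x k ≡ q ℤ.* + (k !)
  k!∣pochℤ (+ zero)  zero    = + 1 , refl
  k!∣pochℤ (+ zero)  (suc k) = + 0 , refl
  k!∣pochℤ (+ suc m) k       = + ℕ∣.quotient (k!∣pochℕ m k) , pochℤ-pos-suc≡*! m k
  k!∣pochℤ -[1+ m ]  k with suc m ℕₚ.<? k
  ... | yes m<k = + 0 , pochℤ-zero -[1+ m ] k ℤ.-≤+
                          (subst (+ 1 ℤ.≤_) (sym (ℤₚ.⊖-≥ (ℕₚ.<⇒≤ m<k))) (ℤ.+≤+ (ℕₚ.m<n⇒0<n∸m m<k)))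
  ... | no m≮k  = (ℤ.-1ℤ ℤ.^ k) ℤ.* + q , (begin
    pochℤ -[1+ m ] k                                          ≡⟨ pochℤ-reflect -[1+ m ] k ⟩
    s ℤ.* pochℤ ((+ 1 ℤ.- -[1+ m ]) ℤ.- + k) k               ≡⟨ cong (λ w → s ℤ.* pochℤ w k) reflected ⟩
    s ℤ.* pochℤ (+ suc (suc m ℕ.∸ k)) k                      ≡⟨ cong (s ℤ.*_) (pochℤ-pos-suc≡*! (suc m ℕ.∸ k) k) ⟩
    s ℤ.* (+ q ℤ.* + (k !))                                   ≡⟨ sym (ℤₚ.*-assoc s (+ q) _) ⟩
    s ℤ.* + q ℤ.* + (k !)                                     ∎)
    where
    open ≡-Reasoning
    s = ℤ.-1ℤ ℤ.^ k
    k≤1+m : k ℕ.≤ suc m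
    k≤1+m = ℕₚ.≮⇒≥ m≮k
    q = ℕ∣.quotient (k!∣pochℕ (suc m ℕ.∸ k) k)
    reflected : (+ 1 ℤ.- -[1+ m ]) ℤ.- + k ≡ + suc (suc m ℕ.∸ k)
    reflected = begin
      + suc (suc m) ℤ.- + k      ≡⟨ ℤₚ.m-n≡m⊖n (suc (suc m)) k ⟩
      suc (suc m) ℤ.⊖ k          ≡⟨ ℤₚ.⊖-≥ (ℕₚ.m≤n⇒m≤1+n k≤1+m) ⟩
      + (suc (suc m) ℕ.∸ k)      ≡⟨ cong +_ (ℕₚ.+-∸-assoc 1 k≤1+m) ⟩
      + suc (suc m ℕ.∸ k)        ∎

  IsInt-poch/! : ∀ x k → IsInt (poch x k * inv (fromℤ (+ (k !))))
  IsInt-poch/! x k = q , (begin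
    fromℤ q                                       ≡⟨ sym (ℚₚ.*-identityʳ (fromℤ q)) ⟩
    fromℤ q * 1ℚ                                  ≡⟨ cong (fromℤ q *_) (sym (fromℤ-inverseʳ (1≤⇒≢0 (ℤ.+≤+ (ℕₚ.1≤n! k))))) ⟩
    fromℤ q * (fromℤ (+ (k !)) * inv k!)          ≡⟨ sym (ℚₚ.*-assoc (fromℤ q) _ _) ⟩
    fromℤ q * fromℤ (+ (k !)) * inv k!            ≡⟨ cong (_* inv k!) (sym (fromℤ-* q (+ (k !)))) ⟩
    fromℤ (q ℤ.* + (k !)) * inv k!                ≡⟨ cong (λ w → fromℤ w * inv k!) (sym (proj₂ (k!∣pochℤ x k))) ⟩
    fromℤ (pochℤ x k) * inv k!                    ≡⟨ cong (_* inv k!) (sym (poch≡fromℤ-pochℤ x k)) ⟩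
    poch x k * inv k!                             ∎)
    where
    open ≡-Reasoning
    q = proj₁ (k!∣pochℤ x k)
    k! = fromℤ (+ (k !))

  -- Partial fractions

  SimpleFractions : Set
  SimpleFractions = List (ℚ × ℤ)

  evalSimple : ℤ → SimpleFractions → ℚ
  evalSimple t []            = 0ℚ
  evalSimple t ((c , k) ∷ L) = c * inv (fromℤ (t ℤ.+ k)) + evalSimple t L

  negateSimple : SimpleFractions → SimpleFractions
  negateSimple = map λ (c , k) → (- c , k)

  evalSimple-++ : ∀ t L M → evalSimple t (L ++ M) ≡ evalSimple t L + evalSimple t M
  evalSimple-++ t []            M = sym (ℚₚ.+-identityˡ _)
  evalSimple-++ t ((c , k) ∷ L) M =
    trans (cong (_+_ (c * inv (fromℤ (t ℤ.+ k)))) (evalSimple-++ t L M))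
          (sym (ℚₚ.+-assoc (c * inv (fromℤ (t ℤ.+ k))) (evalSimple t L) (evalSimple t M)))

  evalSimple-negate : ∀ t L → evalSimple t (negateSimple L) ≡ - evalSimple t L
  evalSimple-negate t []            = refl
  evalSimple-negate t ((c , k) ∷ L) =
    trans (cong₂ _+_ (sym (ℚₚ.neg-distribˡ-* c _)) (evalSimple-negate t L))
          (sym (ℚₚ.neg-distrib-+ (c * inv (fromℤ (t ℤ.+ k))) (evalSimple t L)))

  -- n!/(x)ₙ₊₁ = Σⱼ (-1)ʲ (n choose j)/(x+j) with x = t + a, built from the recursion
  -- (n+1)!/(x)ₙ₊₂ = n!/(x)ₙ₊₁ - n!/(x+1)ₙ₊₁.
  pochFractions : ℕ → ℤ → SimpleFractions
  pochFractions zero    a = (1ℚ , a) ∷ []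
  pochFractions (suc n) a = pochFractions n a ++ negateSimple (pochFractions n (a ℤ.+ + 1))

  poch-telescope : ∀ n x → + 1 ℤ.≤ x →
    fromℤ (+ (n !)) * inv (poch x (suc n)) - fromℤ (+ (n !)) * inv (poch (x ℤ.+ + 1) (suc n))
      ≡ fromℤ (+ (suc n !)) * inv (poch x (suc (suc n)))
  poch-telescope n x 1≤x = begin
    F * inv (X * P) - F * inv (poch (x ℤ.+ + 1) (suc n))  ≡⟨ cong (λ w → F * inv (X * P) - F * inv w) (poch-suc (x ℤ.+ + 1) n) ⟩
    F * inv (X * P) - F * inv (P * Y)                     ≡⟨ cong₂ (λ u v → F * u - F * v) (inv-* X P) (inv-* P Y) ⟩
    F * (inv X * inv P) - F * (inv P * inv Y)             ≡⟨ sym (difference X Y F (inv X) (inv P) (inv Y) X*X⁻¹≡1 Y*Y⁻¹≡1) ⟩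
    ((Y - X) * F) * (inv X * (inv P * inv Y))             ≡⟨ cong₂ (λ u v → (u * F) * (inv X * v)) Y-X≡1+n (sym (inv-* P Y)) ⟩
    (fromℤ (+ suc n) * F) * (inv X * inv (P * Y))         ≡⟨ cong₂ _*_ (sym (fromℤ-pos-* (suc n) (n !))) (sym (inv-* X (P * Y))) ⟩
    fromℤ (+ (suc n !)) * inv (X * (P * Y))               ≡⟨ cong (λ w → fromℤ (+ (suc n !)) * inv (X * w)) (sym (poch-suc (x ℤ.+ + 1) n)) ⟩
    fromℤ (+ (suc n !)) * inv (poch x (suc (suc n)))      ∎
    where
    open ≡-Reasoning
    F = fromℤ (+ (n !))
    X = fromℤ x
    P = poch (x ℤ.+ + 1) n
    Y = fromℤ ((x ℤ.+ + 1) ℤ.+ + n)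
    X*X⁻¹≡1 : X * inv X ≡ 1ℚ
    X*X⁻¹≡1 = fromℤ-inverseʳ (1≤⇒≢0 1≤x)
    Y*Y⁻¹≡1 : Y * inv Y ≡ 1ℚ
    Y*Y⁻¹≡1 = fromℤ-inverseʳ (1≤⇒≢0 (ℤₚ.≤-trans 1≤x (ℤₚ.≤-trans (ℤₚ.i≤i+j x (+ 1)) (ℤₚ.i≤i+j (x ℤ.+ + 1) (+ n)))))
    difference-ℤ : ∀ x k → ((x ℤ.+ + 1) ℤ.+ k) ℤ.- x ≡ + 1 ℤ.+ k
    difference-ℤ = ℤ-Solver.solve-∀
    Y-X≡1+n : Y - X ≡ fromℤ (+ suc n)
    Y-X≡1+n = trans (sym (fromℤ-sub ((x ℤ.+ + 1) ℤ.+ + n) x)) (cong fromℤ (trans (difference-ℤ x (+ n)) (sym (ℤₚ.pos-+ 1 n))))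
    difference : ∀ X Y F iX iP iY → X * iX ≡ 1ℚ → Y * iY ≡ 1ℚ →
                 ((Y - X) * F) * (iX * (iP * iY)) ≡ F * (iX * iP) - F * (iP * iY)
    difference X Y F iX iP iY X*iX≡1 Y*iY≡1 = begin
      ((Y - X) * F) * (iX * (iP * iY))               ≡⟨ solve 6 (λ X Y F iX iP iY → ((Y :- X) :* F) :* (iX :* (iP :* iY)) := F :* iP :* ((Y :* iY) :* iX) :- F :* iP :* ((X :* iX) :* iY)) refl X Y F iX iP iY ⟩
      F * iP * ((Y * iY) * iX) - F * iP * ((X * iX) * iY)   ≡⟨ cong₂ (λ u v → F * iP * (u * iX) - F * iP * (v * iY)) Y*iY≡1 X*iX≡1 ⟩
      F * iP * (1ℚ * iX) - F * iP * (1ℚ * iY)        ≡⟨ solve 4 (λ F iX iP iY → F :* iP :* (con 1ℚ :* iX) :- F :* iP :* (con 1ℚ :* iY) := F :* (iX :* iP) :- F :* (iP :* iY)) refl F iX iP iY ⟩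
      F * (iX * iP) - F * (iP * iY)                  ∎

  pochReciprocal : ℤ → ℕ → ℤ → ℚ
  pochReciprocal a n t = fromℤ (+ (n !)) * inv (poch (t ℤ.+ a) (suc n))

  pochFractions-eval : ∀ n a t → + 1 ℤ.≤ t ℤ.+ a → evalSimple t (pochFractions n a) ≡ pochReciprocal a n t
  pochFractions-eval zero    a t _ =
    trans (ℚₚ.+-identityʳ _) (cong (λ w → 1ℚ * inv w) (sym (ℚₚ.*-identityʳ (fromℤ (t ℤ.+ a)))))
  pochFractions-eval (suc n) a t 1≤t+a = begin
    evalSimple t (pochFractions n a ++ negateSimple (pochFractions n (a ℤ.+ + 1)))
        ≡⟨ evalSimple-++ t (pochFractions n a) _ ⟩
    evalSimple t (pochFractions n a) + evalSimple t (negateSimple (pochFractions n (a ℤ.+ + 1)))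
        ≡⟨ cong (_+_ (evalSimple t (pochFractions n a))) (evalSimple-negate t (pochFractions n (a ℤ.+ + 1))) ⟩
    evalSimple t (pochFractions n a) - evalSimple t (pochFractions n (a ℤ.+ + 1))
        ≡⟨ cong₂ _-_ (pochFractions-eval n a t 1≤t+a) (pochFractions-eval n (a ℤ.+ + 1) t 1≤t+a+1) ⟩
    F * inv (poch (t ℤ.+ a) (suc n)) - F * inv (poch (t ℤ.+ (a ℤ.+ + 1)) (suc n))
        ≡⟨ cong (λ w → F * inv (poch (t ℤ.+ a) (suc n)) - F * inv (poch w (suc n))) (sym (ℤₚ.+-assoc t a (+ 1))) ⟩
    F * inv (poch (t ℤ.+ a) (suc n)) - F * inv (poch ((t ℤ.+ a) ℤ.+ + 1) (suc n))
        ≡⟨ poch-telescope n (t ℤ.+ a) 1≤t+a ⟩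
    fromℤ (+ (suc n !)) * inv (poch (t ℤ.+ a) (suc (suc n)))   ∎
    where
    open ≡-Reasoning
    F = fromℤ (+ (n !))
    1≤t+a+1 : + 1 ℤ.≤ t ℤ.+ (a ℤ.+ + 1)
    1≤t+a+1 = subst (+ 1 ℤ.≤_) (ℤₚ.+-assoc t a (+ 1)) (ℤₚ.≤-trans 1≤t+a (ℤₚ.i≤i+j (t ℤ.+ a) (+ 1)))

  IntegralWithPoleIn : ℤ → ℤ → ℚ × ℤ → Set
  IntegralWithPoleIn lo hi (c , k) = IsInt c × lo ℤ.≤ k × k ℤ.≤ hi

  pochFractions-All : ∀ n a → All (IntegralWithPoleIn a (a ℤ.+ + n)) (pochFractions n a)
  pochFractions-All zero    a = ((+ 1 , refl) , ℤₚ.≤-refl , ℤₚ.≤-reflexive (sym (ℤₚ.+-identityʳ a))) ∷ []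
  pochFractions-All (suc n) a =
    Allₚ.++⁺ (All.map widen (pochFractions-All n a)) (Allₚ.map⁺ (All.map shift (pochFractions-All n (a ℤ.+ + 1))))
    where
    widen : ∀ {x} → IntegralWithPoleIn a (a ℤ.+ + n) x → IntegralWithPoleIn a (a ℤ.+ + suc n) x
    widen (c∈ℤ , a≤k , k≤a+n) = c∈ℤ , a≤k , ℤₚ.≤-trans k≤a+n (ℤₚ.+-monoʳ-≤ a (ℤ.+≤+ (ℕₚ.n≤1+n n)))
    shift : ∀ {x} → IntegralWithPoleIn (a ℤ.+ + 1) ((a ℤ.+ + 1) ℤ.+ + n) x →
            IntegralWithPoleIn a (a ℤ.+ + suc n) (- proj₁ x , proj₂ x)
    shift (c∈ℤ , a+1≤k , k≤a+1+n) =
      IsInt-neg c∈ℤ , ℤₚ.≤-trans (ℤₚ.i≤i+j a (+ 1)) a+1≤k , subst (_ ℤ.≤_) (+1+≡+suc a n) k≤a+1+n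

  data Term : Set where
    simple double : ℚ → ℤ → Term

  pole : Term → ℤ
  pole (simple _ k) = k
  pole (double _ k) = k

  evalTerm : ℤ → Term → ℚ
  evalTerm t (simple c k) = c * inv (fromℤ (t ℤ.+ k))
  evalTerm t (double c k) = c * (inv (fromℤ (t ℤ.+ k)) * inv (fromℤ (t ℤ.+ k)))

  evalTerms : ℤ → List Term → ℚ
  evalTerms t []      = 0ℚ
  evalTerms t (x ∷ L) = evalTerm t x + evalTerms t L

  evalTerms-++ : ∀ t L M → evalTerms t (L ++ M) ≡ evalTerms t L + evalTerms t M
  evalTerms-++ t []      M = sym (ℚₚ.+-identityˡ _)
  evalTerms-++ t (x ∷ L) M = trans (cong (_+_ (evalTerm t x)) (evalTerms-++ t L M))
                                   (sym (ℚₚ.+-assoc (evalTerm t x) (evalTerms t L) (evalTerms t M)))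

  residue : Term → ℚ
  residue (simple c _) = c
  residue (double _ _) = 0ℚ

  doubleCoeff : Term → ℚ
  doubleCoeff (simple _ _) = 0ℚ
  doubleCoeff (double c _) = c

  residueSum : List Term → ℚ
  residueSum []      = 0ℚ
  residueSum (x ∷ L) = residue x + residueSum L

  doubleCoeffSum : List Term → ℚ
  doubleCoeffSum []      = 0ℚ
  doubleCoeffSum (x ∷ L) = doubleCoeff x + doubleCoeffSum L

  multiplySimpleWith : (c : ℚ) (p : ℤ) (d : ℚ) (q : ℤ) → Dec (p ≡ q) → List Term
  multiplySimpleWith c p d q (yes _) = double (c * d) p ∷ []
  multiplySimpleWith c p d q (no _)  =
    simple (c * d * inv (fromℤ (q ℤ.- p))) p ∷ simple (c * d * inv (fromℤ (p ℤ.- q))) q ∷ []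

  multiplySimple : ℚ × ℤ → ℚ × ℤ → List Term
  multiplySimple (c , p) (d , q) = multiplySimpleWith c p d q (p ℤ.≟ q)

  i-j≢0 : ∀ {i j} → i ≢ j → i ℤ.- j ≢ + 0
  i-j≢0 {i} {j} i≢j i-j≡0 = i≢j (ℤₚ.i-j≡0⇒i≡j i j i-j≡0)

  multiplySimpleWith-eval : ∀ t c p d q (p≟q : Dec (p ≡ q)) → + 1 ℤ.≤ t ℤ.+ p → + 1 ℤ.≤ t ℤ.+ q →
    evalTerms t (multiplySimpleWith c p d q p≟q) ≡ (c * inv (fromℤ (t ℤ.+ p))) * (d * inv (fromℤ (t ℤ.+ q)))
  multiplySimpleWith-eval t c p d .p (yes refl) _ _ =
    trans (ℚₚ.+-identityʳ _) (solve 3 (λ c d i → c :* d :* (i :* i) := (c :* i) :* (d :* i)) refl c d (inv (fromℤ (t ℤ.+ p))))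
  multiplySimpleWith-eval t c p d q (no p≢q) 1≤t+p 1≤t+q = begin
    c * d * δ * ip + (c * d * inv (fromℤ (p ℤ.- q)) * iq + 0ℚ)   ≡⟨ cong (λ w → c * d * δ * ip + (c * d * w * iq + 0ℚ)) inv[p-q]≡-δ ⟩
    c * d * δ * ip + (c * d * (- δ) * iq + 0ℚ)                   ≡⟨ solve 5 (λ c d ip iq δ → c :* d :* δ :* ip :+ (c :* d :* (:- δ) :* iq :+ con 0ℚ) := c :* d :* δ :* (ip :* con 1ℚ :- iq :* con 1ℚ)) refl c d ip iq δ ⟩
    c * d * δ * (ip * 1ℚ - iq * 1ℚ)                               ≡⟨ cong₂ (λ u v → c * d * δ * (ip * u - iq * v)) (sym Q*iq≡1) (sym P*ip≡1) ⟩
    c * d * δ * (ip * (Q * iq) - iq * (P * ip))                   ≡⟨ solve 7 (λ c d P Q ip iq δ → c :* d :* δ :* (ip :* (Q :* iq) :- iq :* (P :* ip)) := (c :* ip) :* (d :* iq) :* ((Q :- P) :* δ)) refl c d P Q ip iq δ ⟩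
    (c * ip) * (d * iq) * ((Q - P) * δ)                           ≡⟨ cong ((c * ip) * (d * iq) *_) [Q-P]*δ≡1 ⟩
    (c * ip) * (d * iq) * 1ℚ                                      ≡⟨ ℚₚ.*-identityʳ _ ⟩
    (c * ip) * (d * iq)                                           ∎
    where
    open ≡-Reasoning
    P = fromℤ (t ℤ.+ p)
    Q = fromℤ (t ℤ.+ q)
    ip = inv P
    iq = inv Q
    δ = inv (fromℤ (q ℤ.- p))
    P*ip≡1 : P * ip ≡ 1ℚ
    P*ip≡1 = fromℤ-inverseʳ (1≤⇒≢0 1≤t+p)
    Q*iq≡1 : Q * iq ≡ 1ℚ
    Q*iq≡1 = fromℤ-inverseʳ (1≤⇒≢0 1≤t+q)
    p-q≡-[q-p] : ∀ p q → p ℤ.- q ≡ ℤ.- (q ℤ.- p)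
    p-q≡-[q-p] = ℤ-Solver.solve-∀
    inv[p-q]≡-δ : inv (fromℤ (p ℤ.- q)) ≡ - δ
    inv[p-q]≡-δ = trans (cong inv (trans (cong fromℤ (p-q≡-[q-p] p q)) (fromℤ-neg (q ℤ.- p)))) (inv-neg (fromℤ (q ℤ.- p)))
    [t+q]-[t+p]≡q-p : ∀ t q p → (t ℤ.+ q) ℤ.- (t ℤ.+ p) ≡ q ℤ.- p
    [t+q]-[t+p]≡q-p = ℤ-Solver.solve-∀
    [Q-P]*δ≡1 : (Q - P) * δ ≡ 1ℚ
    [Q-P]*δ≡1 = trans (cong (_* δ) (trans (sym (fromℤ-sub (t ℤ.+ q) (t ℤ.+ p))) (cong fromℤ ([t+q]-[t+p]≡q-p t q p))))
                      (fromℤ-inverseʳ (i-j≢0 (λ q≡p → p≢q (sym q≡p))))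

  multiplyRow : ℚ × ℤ → SimpleFractions → List Term
  multiplyRow x []      = []
  multiplyRow x (y ∷ M) = multiplySimple x y ++ multiplyRow x M

  multiplyFractions : SimpleFractions → SimpleFractions → List Term
  multiplyFractions []      M = []
  multiplyFractions (x ∷ L) M = multiplyRow x M ++ multiplyFractions L M

  multiplyRow-eval : ∀ t c p M → + 1 ℤ.≤ t ℤ.+ p → All (λ y → + 1 ℤ.≤ t ℤ.+ proj₂ y) M →
    evalTerms t (multiplyRow (c , p) M) ≡ (c * inv (fromℤ (t ℤ.+ p))) * evalSimple t M
  multiplyRow-eval t c p []            _ []       = sym (ℚₚ.*-zeroʳ (c * inv (fromℤ (t ℤ.+ p))))
  multiplyRow-eval t c p ((d , q) ∷ M) 1≤t+p (1≤t+q ∷ M-ok) = begin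
    evalTerms t (multiplySimple (c , p) (d , q) ++ multiplyRow (c , p) M)
        ≡⟨ evalTerms-++ t (multiplySimple (c , p) (d , q)) _ ⟩
    evalTerms t (multiplySimple (c , p) (d , q)) + evalTerms t (multiplyRow (c , p) M)
        ≡⟨ cong₂ _+_ (multiplySimpleWith-eval t c p d q (p ℤ.≟ q) 1≤t+p 1≤t+q) (multiplyRow-eval t c p M 1≤t+p M-ok) ⟩
    cp * (d * inv (fromℤ (t ℤ.+ q))) + cp * evalSimple t M
        ≡⟨ sym (ℚₚ.*-distribˡ-+ cp (d * inv (fromℤ (t ℤ.+ q))) (evalSimple t M)) ⟩
    cp * evalSimple t ((d , q) ∷ M)   ∎
    where
    open ≡-Reasoning
    cp = c * inv (fromℤ (t ℤ.+ p))

  multiplyFractions-eval : ∀ t L M → All (λ x → + 1 ℤ.≤ t ℤ.+ proj₂ x) L → All (λ y → + 1 ℤ.≤ t ℤ.+ proj₂ y) M →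
    evalTerms t (multiplyFractions L M) ≡ evalSimple t L * evalSimple t M
  multiplyFractions-eval t []            M []             _    = sym (ℚₚ.*-zeroˡ (evalSimple t M))
  multiplyFractions-eval t ((c , p) ∷ L) M (1≤t+p ∷ L-ok) M-ok = begin
    evalTerms t (multiplyRow (c , p) M ++ multiplyFractions L M)
        ≡⟨ evalTerms-++ t (multiplyRow (c , p) M) _ ⟩
    evalTerms t (multiplyRow (c , p) M) + evalTerms t (multiplyFractions L M)
        ≡⟨ cong₂ _+_ (multiplyRow-eval t c p M 1≤t+p M-ok) (multiplyFractions-eval t L M L-ok M-ok) ⟩
    (c * inv (fromℤ (t ℤ.+ p))) * evalSimple t M + evalSimple t L * evalSimple t M
        ≡⟨ sym (ℚₚ.*-distribʳ-+ (evalSimple t M) (c * inv (fromℤ (t ℤ.+ p))) (evalSimple t L)) ⟩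
    evalSimple t ((c , p) ∷ L) * evalSimple t M   ∎
    where open ≡-Reasoning

  multiplyFractions-All : ∀ {P Q : ℚ × ℤ → Set} {R : Term → Set} →
    (∀ x y → P x → Q y → All R (multiplySimple x y)) →
    ∀ L M → All P L → All Q M → All R (multiplyFractions L M)
  multiplyFractions-All {P} {Q} {R} R-pair = go
    where
    row : ∀ x M → P x → All Q M → All R (multiplyRow x M)
    row x []      _  []         = []
    row x (y ∷ M) px (qy ∷ qM) = Allₚ.++⁺ (R-pair x y px qy) (row x M px qM)
    go : ∀ L M → All P L → All Q M → All R (multiplyFractions L M)
    go []      M []         _  = []
    go (x ∷ L) M (px ∷ pL) qM = Allₚ.++⁺ (row x M px qM) (go L M pL qM)

  multiplySimple-poles : ∀ (Q : ℤ → Set) x y → Q (proj₂ x) → Q (proj₂ y) → All (λ z → Q (pole z)) (multiplySimple x y)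
  multiplySimple-poles Q (c , p) (d , q) Qp Qq with p ℤ.≟ q
  ... | yes _ = Qp ∷ []
  ... | no _  = Qp ∷ Qq ∷ []

  -- (t+c)·β/(t+k) = β + (c-k)·β/(t+k) and (t+c)·α/(t+k)² = α/(t+k) + (c-k)·α/(t+k)²:
  -- the constants β are dropped here and collected by residueSum in mulLinear-eval.
  mulLinearTerm : ℤ → Term → List Term
  mulLinearTerm c (simple β k) = simple (fromℤ (c ℤ.- k) * β) k ∷ []
  mulLinearTerm c (double α k) = simple α k ∷ double (fromℤ (c ℤ.- k) * α) k ∷ []

  mulLinear : ℤ → List Term → List Term
  mulLinear c []      = []
  mulLinear c (x ∷ L) = mulLinearTerm c x ++ mulLinear c L

  fromℤ-+-split : ∀ t c k → fromℤ (t ℤ.+ c) ≡ fromℤ (t ℤ.+ k) + fromℤ (c ℤ.- k)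
  fromℤ-+-split t c k = trans (cong fromℤ (split t c k)) (fromℤ-+ (t ℤ.+ k) (c ℤ.- k))
    where
    split : ∀ t c k → t ℤ.+ c ≡ (t ℤ.+ k) ℤ.+ (c ℤ.- k)
    split = ℤ-Solver.solve-∀

  mulLinearTerm-eval : ∀ t c x → + 1 ℤ.≤ t ℤ.+ pole x →
    evalTerms t (mulLinearTerm c x) + residue x ≡ fromℤ (t ℤ.+ c) * evalTerm t x
  mulLinearTerm-eval t c (simple β k) 1≤t+k = begin
    (Δ * β * i + 0ℚ) + β              ≡⟨ solve 3 (λ Δ β i → (Δ :* β :* i :+ con 0ℚ) :+ β := Δ :* β :* i :+ β :* con 1ℚ) refl Δ β i ⟩
    Δ * β * i + β * 1ℚ                ≡⟨ cong (λ w → Δ * β * i + β * w) (sym (fromℤ-inverseʳ (1≤⇒≢0 1≤t+k))) ⟩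
    Δ * β * i + β * (Y * i)           ≡⟨ solve 4 (λ Y Δ β i → Δ :* β :* i :+ β :* (Y :* i) := (Y :+ Δ) :* (β :* i)) refl Y Δ β i ⟩
    (Y + Δ) * (β * i)                 ≡⟨ cong (_* (β * i)) (sym (fromℤ-+-split t c k)) ⟩
    fromℤ (t ℤ.+ c) * (β * i)         ∎
    where
    open ≡-Reasoning
    Y = fromℤ (t ℤ.+ k)
    Δ = fromℤ (c ℤ.- k)
    i = inv Y
  mulLinearTerm-eval t c (double α k) 1≤t+k = begin
    (α * i + (Δ * α * (i * i) + 0ℚ)) + 0ℚ  ≡⟨ solve 3 (λ Δ α i → (α :* i :+ (Δ :* α :* (i :* i) :+ con 0ℚ)) :+ con 0ℚ := α :* i :* con 1ℚ :+ Δ :* α :* (i :* i)) refl Δ α i ⟩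
    α * i * 1ℚ + Δ * α * (i * i)           ≡⟨ cong (λ w → α * i * w + Δ * α * (i * i)) (sym (fromℤ-inverseʳ (1≤⇒≢0 1≤t+k))) ⟩
    α * i * (Y * i) + Δ * α * (i * i)      ≡⟨ solve 4 (λ Y Δ α i → α :* i :* (Y :* i) :+ Δ :* α :* (i :* i) := (Y :+ Δ) :* (α :* (i :* i))) refl Y Δ α i ⟩
    (Y + Δ) * (α * (i * i))                ≡⟨ cong (_* (α * (i * i))) (sym (fromℤ-+-split t c k)) ⟩
    fromℤ (t ℤ.+ c) * (α * (i * i))        ∎
    where
    open ≡-Reasoning
    Y = fromℤ (t ℤ.+ k)
    Δ = fromℤ (c ℤ.- k)
    i = inv Y

  mulLinear-eval : ∀ t c L → All (λ x → + 1 ℤ.≤ t ℤ.+ pole x) L →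
    evalTerms t (mulLinear c L) + residueSum L ≡ fromℤ (t ℤ.+ c) * evalTerms t L
  mulLinear-eval t c []      []             = sym (ℚₚ.*-zeroʳ (fromℤ (t ℤ.+ c)))
  mulLinear-eval t c (x ∷ L) (x-ok ∷ L-ok) = begin
    evalTerms t (mulLinearTerm c x ++ mulLinear c L) + (residue x + residueSum L)
        ≡⟨ cong (_+ (residue x + residueSum L)) (evalTerms-++ t (mulLinearTerm c x) _) ⟩
    (evalTerms t (mulLinearTerm c x) + evalTerms t (mulLinear c L)) + (residue x + residueSum L)
        ≡⟨ swap (evalTerms t (mulLinearTerm c x)) (evalTerms t (mulLinear c L)) (residue x) (residueSum L) ⟩
    (evalTerms t (mulLinearTerm c x) + residue x) + (evalTerms t (mulLinear c L) + residueSum L)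
        ≡⟨ cong₂ _+_ (mulLinearTerm-eval t c x x-ok) (mulLinear-eval t c L L-ok) ⟩
    fromℤ (t ℤ.+ c) * evalTerm t x + fromℤ (t ℤ.+ c) * evalTerms t L
        ≡⟨ sym (ℚₚ.*-distribˡ-+ (fromℤ (t ℤ.+ c)) (evalTerm t x) (evalTerms t L)) ⟩
    fromℤ (t ℤ.+ c) * evalTerms t (x ∷ L)   ∎
    where
    open ≡-Reasoning
    swap : ∀ a b c d → (a + b) + (c + d) ≡ (a + c) + (b + d)
    swap = solve 4 (λ a b c d → (a :+ b) :+ (c :+ d) := (a :+ c) :+ (b :+ d)) refl

  mulLinear-All : ∀ {P Q : Term → Set} c → (∀ x → P x → All Q (mulLinearTerm c x)) →
    ∀ L → All P L → All Q (mulLinear c L)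
  mulLinear-All c Q-step []      []         = []
  mulLinear-All c Q-step (x ∷ L) (px ∷ pL) = Allₚ.++⁺ (Q-step x px) (mulLinear-All c Q-step L pL)

  mulLinearTerm-poles : ∀ (Q : ℤ → Set) c x → Q (pole x) → All (λ y → Q (pole y)) (mulLinearTerm c x)
  mulLinearTerm-poles Q c (simple _ _) q = q ∷ []
  mulLinearTerm-poles Q c (double _ _) q = q ∷ q ∷ []

  mulPoch : ℤ → List Term → ℕ → List Term
  mulPoch b L zero    = L
  mulPoch b L (suc s) = mulLinear (b ℤ.+ + s) (mulPoch b L s)

  mulPoch-All : ∀ {P : ℕ → Term → Set} b → (∀ s x → P s x → All (P (suc s)) (mulLinearTerm (b ℤ.+ + s) x)) →
    ∀ L s → All (P 0) L → All (P s) (mulPoch b L s)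
  mulPoch-All b P-step L zero    pL = pL
  mulPoch-All b P-step L (suc s) pL = mulLinear-All (b ℤ.+ + s) (P-step s) (mulPoch b L s) (mulPoch-All b P-step L s pL)

  mulPoch-poles : ∀ (Q : ℤ → Set) b L s → All (λ x → Q (pole x)) L → All (λ x → Q (pole x)) (mulPoch b L s)
  mulPoch-poles Q b = mulPoch-All {λ _ x → Q (pole x)} b (λ s → mulLinearTerm-poles Q (b ℤ.+ + s))

  mulPoch-eval : ∀ t b L s → All (λ x → + 1 ℤ.≤ t ℤ.+ pole x) L →
    (∀ r → r ℕ.< s → residueSum (mulPoch b L r) ≡ 0ℚ) →
    evalTerms t (mulPoch b L s) ≡ poch (t ℤ.+ b) s * evalTerms t L
  mulPoch-eval t b L zero    _    _         = sym (ℚₚ.*-identityˡ _)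
  mulPoch-eval t b L (suc s) L-ok residues0 = begin
    evalTerms t (mulLinear c S)                       ≡⟨ sym (ℚₚ.+-identityʳ _) ⟩
    evalTerms t (mulLinear c S) + 0ℚ                  ≡⟨ cong (_+_ (evalTerms t (mulLinear c S))) (sym (residues0 s ℕₚ.≤-refl)) ⟩
    evalTerms t (mulLinear c S) + residueSum S        ≡⟨ mulLinear-eval t c S (mulPoch-poles (λ k → + 1 ℤ.≤ t ℤ.+ k) b L s L-ok) ⟩
    fromℤ (t ℤ.+ c) * evalTerms t S                   ≡⟨ cong (fromℤ (t ℤ.+ c) *_) (mulPoch-eval t b L s L-ok (λ r r<s → residues0 r (ℕₚ.m≤n⇒m≤1+n r<s))) ⟩
    fromℤ (t ℤ.+ c) * (poch (t ℤ.+ b) s * evalTerms t L)   ≡⟨ solve 3 (λ a b c → a :* (b :* c) := (b :* a) :* c) refl (fromℤ (t ℤ.+ c)) (poch (t ℤ.+ b) s) (evalTerms t L) ⟩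
    (poch (t ℤ.+ b) s * fromℤ (t ℤ.+ c)) * evalTerms t L   ≡⟨ cong (λ w → (poch (t ℤ.+ b) s * fromℤ w) * evalTerms t L) (sym (ℤₚ.+-assoc t b (+ s))) ⟩
    (poch (t ℤ.+ b) s * fromℤ ((t ℤ.+ b) ℤ.+ + s)) * evalTerms t L   ≡⟨ cong (_* evalTerms t L) (sym (poch-suc (t ℤ.+ b) s)) ⟩
    poch (t ℤ.+ b) (suc s) * evalTerms t L             ∎
    where
    open ≡-Reasoning
    c = b ℤ.+ + s
    S = mulPoch b L s

  scaleTerm : ℚ → Term → Term
  scaleTerm a (simple c k) = simple (a * c) k
  scaleTerm a (double c k) = double (a * c) k

  scaleTerms : ℚ → List Term → List Term
  scaleTerms a = map (scaleTerm a)

  pole-scaleTerm : ∀ a x → pole (scaleTerm a x) ≡ pole x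
  pole-scaleTerm a (simple _ _) = refl
  pole-scaleTerm a (double _ _) = refl

  scaleTerms-poles : ∀ (Q : ℤ → Set) a L → All (λ x → Q (pole x)) L → All (λ x → Q (pole x)) (scaleTerms a L)
  scaleTerms-poles Q a L QL = Allₚ.map⁺ (All.map (λ {x} → subst Q (sym (pole-scaleTerm a x))) QL)

  evalTerms-scale : ∀ t a L → evalTerms t (scaleTerms a L) ≡ a * evalTerms t L
  evalTerms-scale t a []             = sym (ℚₚ.*-zeroʳ a)
  evalTerms-scale t a (simple c k ∷ L) =
    trans (cong₂ _+_ (ℚₚ.*-assoc a c _) (evalTerms-scale t a L)) (sym (ℚₚ.*-distribˡ-+ a _ _))
  evalTerms-scale t a (double c k ∷ L) =
    trans (cong₂ _+_ (ℚₚ.*-assoc a c _) (evalTerms-scale t a L)) (sym (ℚₚ.*-distribˡ-+ a _ _))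

  residueSum-scale : ∀ a L → residueSum (scaleTerms a L) ≡ a * residueSum L
  residueSum-scale a []               = sym (ℚₚ.*-zeroʳ a)
  residueSum-scale a (simple c k ∷ L) =
    trans (cong (_+_ (a * c)) (residueSum-scale a L)) (sym (ℚₚ.*-distribˡ-+ a c (residueSum L)))
  residueSum-scale a (double c k ∷ L) =
    trans (cong₂ _+_ (sym (ℚₚ.*-zeroʳ a)) (residueSum-scale a L)) (sym (ℚₚ.*-distribˡ-+ a 0ℚ (residueSum L)))

  -- Estimates of order 1/N

  1/[1+_] : ℕ → ℚ
  1/[1+ N ] = inv (fromℤ (+ suc N))

  1/[1+]≡mkℚ : ∀ N → 1/[1+ N ] ≡ mkℚ (+ 1) N _
  1/[1+]≡mkℚ N = cong inv (fromℤ≡mkℚ (+ suc N))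

  1/[1+]-pos : ∀ N → 0ℚ < 1/[1+ N ]
  1/[1+]-pos N = subst (0ℚ <_) (sym (1/[1+]≡mkℚ N)) (*<* (ℤ.+<+ (s≤s z≤n)))

  1/[1+]-nonNeg : ∀ N → 0ℚ ≤ 1/[1+ N ]
  1/[1+]-nonNeg N = ℚₚ.<⇒≤ (1/[1+]-pos N)

  1/[1+]-antimono : ∀ {M N} → M ℕ.≤ N → 1/[1+ N ] ≤ 1/[1+ M ]
  1/[1+]-antimono {M} {N} M≤N = subst₂ _≤_ (sym (1/[1+]≡mkℚ N)) (sym (1/[1+]≡mkℚ M))
    (*≤* (ℤ.+≤+ (subst₂ ℕ._≤_ (sym (ℕₚ.+-identityʳ (suc M))) (sym (ℕₚ.+-identityʳ (suc N))) (s≤s M≤N))))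

  1/[1+]≤1 : ∀ N → 1/[1+ N ] ≤ 1ℚ
  1/[1+]≤1 N = 1/[1+]-antimono {0} {N} z≤n

  1/[1+]-inverse : ∀ N → fromℤ (+ suc N) * 1/[1+ N ] ≡ 1ℚ
  1/[1+]-inverse N = fromℤ-inverseʳ {+ suc N} (λ ())

  inv-fromℤ-bounds : ∀ w N → + suc N ℤ.≤ w → 0ℚ ≤ inv (fromℤ w) × inv (fromℤ w) ≤ 1/[1+ N ]
  inv-fromℤ-bounds (+ suc k) N (ℤ.+≤+ (s≤s N≤k)) = 1/[1+]-nonNeg k , 1/[1+]-antimono N≤k

  *-monoˡ-≤-0≤ : ∀ r {p q} → 0ℚ ≤ r → p ≤ q → r * p ≤ r * q
  *-monoˡ-≤-0≤ r 0≤r = ℚₚ.*-monoˡ-≤-nonNeg r {{nonNegative 0≤r}}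

  *-monoʳ-≤-0≤ : ∀ r {p q} → 0ℚ ≤ r → p ≤ q → p * r ≤ q * r
  *-monoʳ-≤-0≤ r 0≤r = ℚₚ.*-monoʳ-≤-nonNeg r {{nonNegative 0≤r}}

  *-monoʳ-<-0< : ∀ r {p q} → 0ℚ < r → p < q → p * r < q * r
  *-monoʳ-<-0< r 0<r = ℚₚ.*-monoˡ-<-pos r {{positive 0<r}}

  *-mono-≤-0≤ : ∀ {a b c d} → 0ℚ ≤ a → 0ℚ ≤ c → a ≤ b → c ≤ d → a * c ≤ b * d
  *-mono-≤-0≤ {a} {b} {c} {d} 0≤a 0≤c a≤b c≤d =
    ℚₚ.≤-trans (*-monoʳ-≤-0≤ c 0≤c a≤b) (*-monoˡ-≤-0≤ b (ℚₚ.≤-trans 0≤a a≤b) c≤d)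

  0≤* : ∀ {p q} → 0ℚ ≤ p → 0ℚ ≤ q → 0ℚ ≤ p * q
  0≤* {p} {q} 0≤p 0≤q = subst (_≤ p * q) (ℚₚ.*-zeroˡ q) (*-monoʳ-≤-0≤ q 0≤q 0≤p)

  0≤+ : ∀ {p q} → 0ℚ ≤ p → 0ℚ ≤ q → 0ℚ ≤ p + q
  0≤+ {p} {q} 0≤p 0≤q = subst (_≤ p + q) (ℚₚ.+-identityˡ 0ℚ) (ℚₚ.+-mono-≤ 0≤p 0≤q)

  p≤1+p : ∀ p → p ≤ 1ℚ + p
  p≤1+p p = subst (_≤ 1ℚ + p) (ℚₚ.+-identityˡ p) (ℚₚ.+-monoˡ-≤ p (ℚₚ.<⇒≤ (ℚₚ.positive⁻¹ 1ℚ)))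

  0≤⇒∣∣≤ : ∀ {d c} → 0ℚ ≤ d → d ≤ c → ∣ d ∣ ≤ c
  0≤⇒∣∣≤ 0≤d d≤c = subst (_≤ _) (sym (ℚₚ.0≤p⇒∣p∣≡p 0≤d)) d≤c

  p≤fromℤ∣↥p∣ : ∀ p → p ≤ fromℤ (+ ℤ.∣ ℚ.↥ p ∣)
  p≤fromℤ∣↥p∣ p@(mkℚ (+ n) d _)  = subst (p ≤_) (sym (fromℤ≡mkℚ (+ n)))
    (*≤* (subst₂ ℤ._≤_ (ℤₚ.pos-* n 1) (ℤₚ.pos-* n (suc d)) (ℤ.+≤+ (ℕₚ.*-monoʳ-≤ n (s≤s z≤n)))))
  p≤fromℤ∣↥p∣ p@(mkℚ -[1+ n ] d _) = ℚₚ.≤-trans (*≤* ℤ.-≤+) (fromℤ-nonNeg (suc n))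

  archimedean : ∀ C ε → 0ℚ ≤ C → 0ℚ < ε → Σ ℕ λ M → C * 1/[1+ M ] < ε
  archimedean C ε 0≤C 0<ε = m , (begin-strict
    C * 1/[1+ m ]                          <⟨ *-monoʳ-<-0< 1/[1+ m ] (1/[1+]-pos m) C<[1+m]ε ⟩
    fromℤ (+ suc m) * ε * 1/[1+ m ]        ≡⟨ solve 3 (λ x e i → x :* e :* i := e :* (x :* i)) refl (fromℤ (+ suc m)) ε 1/[1+ m ] ⟩
    ε * (fromℤ (+ suc m) * 1/[1+ m ])      ≡⟨ cong (ε *_) (1/[1+]-inverse m) ⟩
    ε * 1ℚ                                 ≡⟨ ℚₚ.*-identityʳ ε ⟩
    ε                                      ∎)
    where
    open ℚₚ.≤-Reasoning
    q = C * inv ε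
    m = ℤ.∣ ℚ.↥ q ∣
    C≡qε : C ≡ q * ε
    C≡qε = sym (begin-equality
      C * inv ε * ε      ≡⟨ ℚₚ.*-assoc C (inv ε) ε ⟩
      C * (inv ε * ε)    ≡⟨ cong (C *_) (trans (ℚₚ.*-comm (inv ε) ε) (inv-inverseʳ ε (λ ε≡0 → ℚₚ.<-irrefl (sym ε≡0) 0<ε))) ⟩
      C * 1ℚ             ≡⟨ ℚₚ.*-identityʳ C ⟩
      C                  ∎)
    C<[1+m]ε : C < fromℤ (+ suc m) * ε
    C<[1+m]ε = begin-strict
      C                        ≡⟨ C≡qε ⟩
      q * ε                    ≤⟨ *-monoʳ-≤-0≤ ε (ℚₚ.<⇒≤ 0<ε) (p≤fromℤ∣↥p∣ q) ⟩
      fromℤ (+ m) * ε          <⟨ *-monoʳ-<-0< ε 0<ε (fromℤ-mono-< (ℤ.+<+ (ℕₚ.n<1+n m))) ⟩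
      fromℤ (+ suc m) * ε      ∎

  ≤C/[1+N]⇒ConvergesTo : ∀ (s : ℕ → ℚ) L C → 0ℚ ≤ C → (∀ N → ∣ s N - L ∣ ≤ C * 1/[1+ N ]) → ConvergesTo s L
  ≤C/[1+N]⇒ConvergesTo s L C 0≤C bound ε 0<ε = M , λ N M≤N →
    ℚₚ.≤-<-trans (ℚₚ.≤-trans (bound N) (*-monoˡ-≤-0≤ C 0≤C (1/[1+]-antimono M≤N))) CM<ε
    where
    M : ℕ
    M = proj₁ (archimedean C ε 0≤C 0<ε)
    CM<ε : C * 1/[1+ M ] < ε
    CM<ε = proj₂ (archimedean C ε 0≤C 0<ε)

  ≤C/[1+N]⇒≡0 : ∀ q C → 0ℚ ≤ C → (∀ N → ∣ q ∣ ≤ C * 1/[1+ N ]) → q ≡ 0ℚ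
  ≤C/[1+N]⇒≡0 q C 0≤C bound with ℚₚ.<-cmp 0ℚ ∣ q ∣
  ... | tri< 0<∣q∣ _ _ = ⊥-elim (ℚₚ.<-irrefl refl (ℚₚ.≤-<-trans (bound M) CM<∣q∣))
    where
    M : ℕ
    M = proj₁ (archimedean C ∣ q ∣ 0≤C 0<∣q∣)
    CM<∣q∣ : C * 1/[1+ M ] < ∣ q ∣
    CM<∣q∣ = proj₂ (archimedean C ∣ q ∣ 0≤C 0<∣q∣)
  ... | tri≈ _ 0≡∣q∣ _ = ℚₚ.∣p∣≡0⇒p≡0 q (sym 0≡∣q∣)
  ... | tri> _ _ ∣q∣<0 = ⊥-elim (ℚₚ.<-irrefl refl (ℚₚ.<-≤-trans ∣q∣<0 (ℚₚ.0≤∣p∣ q)))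

  coeff : Term → ℚ
  coeff (simple c _) = c
  coeff (double c _) = c

  termBound : Term → ℚ
  termBound x = ∣ coeff x ∣ * (1ℚ + ∣ fromℤ (pole x) ∣)

  termsBound : List Term → ℚ
  termsBound []      = 0ℚ
  termsBound (x ∷ L) = termBound x + termsBound L

  termsBound-nonNeg : ∀ L → 0ℚ ≤ termsBound L
  termsBound-nonNeg []      = ℚₚ.≤-refl
  termsBound-nonNeg (x ∷ L) = 0≤+ (0≤* (ℚₚ.0≤∣p∣ (coeff x)) 0≤1+∣k∣) (termsBound-nonNeg L)
    where
    0≤1+∣k∣ : 0ℚ ≤ 1ℚ + ∣ fromℤ (pole x) ∣
    0≤1+∣k∣ = ℚₚ.≤-trans (ℚₚ.0≤∣p∣ (fromℤ (pole x))) (p≤1+p ∣ fromℤ (pole x) ∣)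

  t*simple≡ : ∀ T K c i → (T + K) * i ≡ 1ℚ → T * (c * i) - c ≡ - (c * (K * i))
  t*simple≡ T K c i [T+K]*i≡1 = begin
    T * (c * i) - c                    ≡⟨ cong (λ w → T * (c * i) - w) (sym (ℚₚ.*-identityʳ c)) ⟩
    T * (c * i) - c * 1ℚ               ≡⟨ cong (λ w → T * (c * i) - c * w) (sym [T+K]*i≡1) ⟩
    T * (c * i) - c * ((T + K) * i)    ≡⟨ solve 4 (λ T K c i → T :* (c :* i) :- c :* ((T :+ K) :* i) := :- (c :* (K :* i))) refl T K c i ⟩
    - (c * (K * i))                    ∎
    where open ≡-Reasoning

  t*double≡ : ∀ T K c i → (T + K) * i ≡ 1ℚ → T * (c * (i * i)) - 0ℚ ≡ c * i * (1ℚ - K * i)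
  t*double≡ T K c i [T+K]*i≡1 = begin
    T * (c * (i * i)) - 0ℚ           ≡⟨ solve 4 (λ T K c i → T :* (c :* (i :* i)) :- con 0ℚ := c :* i :* ((T :+ K) :* i :- K :* i)) refl T K c i ⟩
    c * i * ((T + K) * i - K * i)    ≡⟨ cong (λ w → c * i * (w - K * i)) [T+K]*i≡1 ⟩
    c * i * (1ℚ - K * i)             ∎
    where open ≡-Reasoning

  [t+k]*inv≡1 : ∀ t k N → + suc N ℤ.≤ t ℤ.+ k → (fromℤ t + fromℤ k) * inv (fromℤ (t ℤ.+ k)) ≡ 1ℚ
  [t+k]*inv≡1 t k N N<t+k = trans (cong (_* inv (fromℤ (t ℤ.+ k))) (sym (fromℤ-+ t k)))
    (fromℤ-inverseʳ (1≤⇒≢0 (ℤₚ.≤-trans (ℤ.+≤+ (s≤s z≤n)) N<t+k)))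

  t*evalTerm-residue-bound : ∀ t N x → + suc N ℤ.≤ t ℤ.+ pole x →
    ∣ fromℤ t * evalTerm t x - residue x ∣ ≤ termBound x * 1/[1+ N ]
  t*evalTerm-residue-bound t N (simple c k) N<t+k = begin
    ∣ T * (c * i) - c ∣           ≡⟨ cong ∣_∣ (t*simple≡ T K c i ([t+k]*inv≡1 t k N N<t+k)) ⟩
    ∣ - (c * (K * i)) ∣           ≡⟨ trans (ℚₚ.∣-p∣≡∣p∣ _) (trans (ℚₚ.∣p*q∣≡∣p∣*∣q∣ c _) (cong (∣ c ∣ *_) (ℚₚ.∣p*q∣≡∣p∣*∣q∣ K i))) ⟩
    ∣ c ∣ * (∣ K ∣ * ∣ i ∣)       ≡⟨ cong (λ w → ∣ c ∣ * (∣ K ∣ * w)) (ℚₚ.0≤p⇒∣p∣≡p 0≤i) ⟩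
    ∣ c ∣ * (∣ K ∣ * i)           ≤⟨ *-monoˡ-≤-0≤ ∣ c ∣ (ℚₚ.0≤∣p∣ c) (*-mono-≤-0≤ (ℚₚ.0≤∣p∣ K) 0≤i (p≤1+p ∣ K ∣) i≤1/[1+N]) ⟩
    ∣ c ∣ * ((1ℚ + ∣ K ∣) * 1/[1+ N ])   ≡⟨ sym (ℚₚ.*-assoc ∣ c ∣ _ _) ⟩
    ∣ c ∣ * (1ℚ + ∣ K ∣) * 1/[1+ N ]     ∎
    where
    open ℚₚ.≤-Reasoning
    T = fromℤ t
    K = fromℤ k
    i = inv (fromℤ (t ℤ.+ k))
    0≤i : 0ℚ ≤ i
    0≤i = proj₁ (inv-fromℤ-bounds (t ℤ.+ k) N N<t+k)
    i≤1/[1+N] : i ≤ 1/[1+ N ]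
    i≤1/[1+N] = proj₂ (inv-fromℤ-bounds (t ℤ.+ k) N N<t+k)
  t*evalTerm-residue-bound t N (double c k) N<t+k = begin
    ∣ T * (c * (i * i)) - 0ℚ ∣                ≡⟨ cong ∣_∣ (t*double≡ T K c i ([t+k]*inv≡1 t k N N<t+k)) ⟩
    ∣ c * i * (1ℚ - K * i) ∣                  ≡⟨ trans (ℚₚ.∣p*q∣≡∣p∣*∣q∣ (c * i) _) (cong (_* ∣ 1ℚ - K * i ∣) (trans (ℚₚ.∣p*q∣≡∣p∣*∣q∣ c i) (cong (∣ c ∣ *_) (ℚₚ.0≤p⇒∣p∣≡p 0≤i)))) ⟩
    ∣ c ∣ * i * ∣ 1ℚ - K * i ∣               ≤⟨ *-monoˡ-≤-0≤ (∣ c ∣ * i) 0≤∣c∣i (ℚₚ.∣p-q∣≤∣p∣+∣q∣ 1ℚ (K * i)) ⟩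
    ∣ c ∣ * i * (1ℚ + ∣ K * i ∣)             ≤⟨ *-monoˡ-≤-0≤ (∣ c ∣ * i) 0≤∣c∣i (ℚₚ.+-monoʳ-≤ 1ℚ ∣Ki∣≤∣K∣) ⟩
    ∣ c ∣ * i * (1ℚ + ∣ K ∣)                 ≤⟨ *-monoʳ-≤-0≤ (1ℚ + ∣ K ∣) (ℚₚ.≤-trans (ℚₚ.0≤∣p∣ K) (p≤1+p ∣ K ∣)) (*-monoˡ-≤-0≤ ∣ c ∣ (ℚₚ.0≤∣p∣ c) i≤1/[1+N]) ⟩
    ∣ c ∣ * 1/[1+ N ] * (1ℚ + ∣ K ∣)         ≡⟨ solve 3 (λ a b c → a :* b :* c := a :* c :* b) refl ∣ c ∣ 1/[1+ N ] (1ℚ + ∣ K ∣) ⟩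
    ∣ c ∣ * (1ℚ + ∣ K ∣) * 1/[1+ N ]         ∎
    where
    open ℚₚ.≤-Reasoning
    T = fromℤ t
    K = fromℤ k
    i = inv (fromℤ (t ℤ.+ k))
    0≤i : 0ℚ ≤ i
    0≤i = proj₁ (inv-fromℤ-bounds (t ℤ.+ k) N N<t+k)
    i≤1/[1+N] : i ≤ 1/[1+ N ]
    i≤1/[1+N] = proj₂ (inv-fromℤ-bounds (t ℤ.+ k) N N<t+k)
    0≤∣c∣i : 0ℚ ≤ ∣ c ∣ * i
    0≤∣c∣i = 0≤* (ℚₚ.0≤∣p∣ c) 0≤i
    ∣Ki∣≤∣K∣ : ∣ K * i ∣ ≤ ∣ K ∣
    ∣Ki∣≤∣K∣ = begin
      ∣ K * i ∣        ≡⟨ trans (ℚₚ.∣p*q∣≡∣p∣*∣q∣ K i) (cong (∣ K ∣ *_) (ℚₚ.0≤p⇒∣p∣≡p 0≤i)) ⟩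
      ∣ K ∣ * i        ≤⟨ *-monoˡ-≤-0≤ ∣ K ∣ (ℚₚ.0≤∣p∣ K) (ℚₚ.≤-trans i≤1/[1+N] (1/[1+]≤1 N)) ⟩
      ∣ K ∣ * 1ℚ       ≡⟨ ℚₚ.*-identityʳ ∣ K ∣ ⟩
      ∣ K ∣            ∎

  t*evalTerms-residueSum-bound : ∀ t N L → All (λ x → + suc N ℤ.≤ t ℤ.+ pole x) L →
    ∣ fromℤ t * evalTerms t L - residueSum L ∣ ≤ termsBound L * 1/[1+ N ]
  t*evalTerms-residueSum-bound t N [] [] =
    subst (_≤ 0ℚ * 1/[1+ N ]) (sym (cong ∣_∣ (solve 1 (λ T → T :* con 0ℚ :- con 0ℚ := con 0ℚ) refl (fromℤ t))))
          (ℚₚ.≤-reflexive (sym (ℚₚ.*-zeroˡ 1/[1+ N ])))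
  t*evalTerms-residueSum-bound t N (x ∷ L) (x-ok ∷ L-ok) = begin
    ∣ T * (evalTerm t x + evalTerms t L) - (residue x + residueSum L) ∣
        ≡⟨ cong ∣_∣ (solve 5 (λ T e E b B → T :* (e :+ E) :- (b :+ B) := (T :* e :- b) :+ (T :* E :- B)) refl T (evalTerm t x) (evalTerms t L) (residue x) (residueSum L)) ⟩
    ∣ (T * evalTerm t x - residue x) + (T * evalTerms t L - residueSum L) ∣
        ≤⟨ ℚₚ.∣p+q∣≤∣p∣+∣q∣ (T * evalTerm t x - residue x) (T * evalTerms t L - residueSum L) ⟩
    ∣ T * evalTerm t x - residue x ∣ + ∣ T * evalTerms t L - residueSum L ∣
        ≤⟨ ℚₚ.+-mono-≤ (t*evalTerm-residue-bound t N x x-ok) (t*evalTerms-residueSum-bound t N L L-ok) ⟩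
    termBound x * 1/[1+ N ] + termsBound L * 1/[1+ N ]
        ≡⟨ sym (ℚₚ.*-distribʳ-+ 1/[1+ N ] (termBound x) (termsBound L)) ⟩
    termsBound (x ∷ L) * 1/[1+ N ]   ∎
    where
    open ℚₚ.≤-Reasoning
    T = fromℤ t

  -- The summation variable: τ a₀ 0 = 1 - a₀ is the smallest admissible starting point t₀.
  τ : ℤ → ℕ → ℤ
  τ a₀ N = (+ 1 ℤ.- a₀) ℤ.+ + N

  τ+a≡pos : ∀ a₀ a N → a₀ ℤ.≤ a → τ a₀ N ℤ.+ a ≡ + (suc N ℕ.+ ℤ.∣ a ℤ.- a₀ ∣)
  τ+a≡pos a₀ a N a₀≤a = begin
    τ a₀ N ℤ.+ a                          ≡⟨ regroup a₀ a (+ N) ⟩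
    (+ 1 ℤ.+ + N) ℤ.+ (a ℤ.- a₀)          ≡⟨ cong₂ ℤ._+_ (sym (ℤₚ.pos-+ 1 N)) (sym (ℤₚ.0≤i⇒+∣i∣≡i (ℤₚ.i≤j⇒0≤j-i a₀≤a))) ⟩
    + suc N ℤ.+ + ℤ.∣ a ℤ.- a₀ ∣          ≡⟨ sym (ℤₚ.pos-+ (suc N) _) ⟩
    + (suc N ℕ.+ ℤ.∣ a ℤ.- a₀ ∣)          ∎
    where
    open ≡-Reasoning
    regroup : ∀ a₀ a N → ((+ 1 ℤ.- a₀) ℤ.+ N) ℤ.+ a ≡ (+ 1 ℤ.+ N) ℤ.+ (a ℤ.- a₀)
    regroup = ℤ-Solver.solve-∀

  1+N≤τ+a : ∀ a₀ a N → a₀ ℤ.≤ a → + suc N ℤ.≤ τ a₀ N ℤ.+ a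
  1+N≤τ+a a₀ a N a₀≤a = subst (+ suc N ℤ.≤_) (sym (τ+a≡pos a₀ a N a₀≤a)) (ℤ.+≤+ (ℕₚ.m≤m+n (suc N) _))

  1≤τ+a : ∀ a₀ a N → a₀ ℤ.≤ a → + 1 ℤ.≤ τ a₀ N ℤ.+ a
  1≤τ+a a₀ a N a₀≤a = ℤₚ.≤-trans (ℤ.+≤+ (s≤s z≤n)) (1+N≤τ+a a₀ a N a₀≤a)

  poch-τ : ∀ a₀ a N n → a₀ ℤ.≤ a → poch (τ a₀ N ℤ.+ a) n ≡ fromℤ (+ pochℕ (suc N ℕ.+ ℤ.∣ a ℤ.- a₀ ∣) n)
  poch-τ a₀ a N n a₀≤a = trans (poch≡fromℤ-pochℤ _ n)
    (cong fromℤ (trans (cong (λ w → pochℤ w n) (τ+a≡pos a₀ a N a₀≤a)) (pochℤ-pos _ n)))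

  ∣u+y∣≤[1+∣y∣]*u : ∀ N y → ℤ.∣ + suc N ℤ.+ y ∣ ℕ.≤ (1 ℕ.+ ℤ.∣ y ∣) ℕ.* suc N
  ∣u+y∣≤[1+∣y∣]*u N y = begin
    ℤ.∣ + suc N ℤ.+ y ∣          ≤⟨ ℤₚ.∣i+j∣≤∣i∣+∣j∣ (+ suc N) y ⟩
    suc N ℕ.+ ℤ.∣ y ∣            ≤⟨ ℕₚ.+-monoʳ-≤ (suc N) (ℕₚ.m≤m*n ℤ.∣ y ∣ (suc N)) ⟩
    suc N ℕ.+ ℤ.∣ y ∣ ℕ.* suc N  ≡⟨ regroup (suc N) ℤ.∣ y ∣ ⟩
    (1 ℕ.+ ℤ.∣ y ∣) ℕ.* suc N    ∎
    where
    open ℕₚ.≤-Reasoning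
    regroup : ∀ u y → u ℕ.+ y ℕ.* u ≡ (1 ℕ.+ y) ℕ.* u
    regroup = ℕ-Solver.solve-∀

  pochBound : ℤ → ℕ → ℕ
  pochBound y zero    = 1
  pochBound y (suc s) = (1 ℕ.+ ℤ.∣ y ∣) ℕ.* pochBound (y ℤ.+ + 1) s

  ∣pochℤ∣≤ : ∀ N y s → ℤ.∣ pochℤ (+ suc N ℤ.+ y) s ∣ ℕ.≤ pochBound y s ℕ.* suc N ^ s
  ∣pochℤ∣≤ N y zero    = s≤s z≤n
  ∣pochℤ∣≤ N y (suc s) = begin
    ℤ.∣ (u ℤ.+ y) ℤ.* pochℤ ((u ℤ.+ y) ℤ.+ + 1) s ∣                 ≡⟨ ℤₚ.abs-* (u ℤ.+ y) _ ⟩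
    ℤ.∣ u ℤ.+ y ∣ ℕ.* ℤ.∣ pochℤ ((u ℤ.+ y) ℤ.+ + 1) s ∣             ≡⟨ cong (λ w → ℤ.∣ u ℤ.+ y ∣ ℕ.* ℤ.∣ pochℤ w s ∣) (ℤₚ.+-assoc u y (+ 1)) ⟩
    ℤ.∣ u ℤ.+ y ∣ ℕ.* ℤ.∣ pochℤ (u ℤ.+ (y ℤ.+ + 1)) s ∣             ≤⟨ ℕₚ.*-mono-≤ (∣u+y∣≤[1+∣y∣]*u N y) (∣pochℤ∣≤ N (y ℤ.+ + 1) s) ⟩
    ((1 ℕ.+ ℤ.∣ y ∣) ℕ.* suc N) ℕ.* (pochBound (y ℤ.+ + 1) s ℕ.* suc N ^ s)
        ≡⟨ regroup (1 ℕ.+ ℤ.∣ y ∣) (suc N) (pochBound (y ℤ.+ + 1) s) (suc N ^ s) ⟩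
    pochBound y (suc s) ℕ.* suc N ^ suc s                           ∎
    where
    open ℕₚ.≤-Reasoning
    u = + suc N
    regroup : ∀ a u k p → (a ℕ.* u) ℕ.* (k ℕ.* p) ≡ (a ℕ.* k) ℕ.* (u ℕ.* p)
    regroup = ℕ-Solver.solve-∀

  ∣z/D∣≤K/[1+N] : ∀ z D K N → 1 ℕ.≤ D → ℤ.∣ z ∣ ℕ.* suc N ℕ.≤ K ℕ.* D →
    ∣ fromℤ z * inv (fromℤ (+ D)) ∣ ≤ fromℤ (+ K) * 1/[1+ N ]
  ∣z/D∣≤K/[1+N] z D K N 1≤D ∣z∣u≤KD = ℚₚ.*-cancelʳ-≤-pos (Dq * u) {{positive 0<Dq*u}} (begin
    ∣ fromℤ z * inv Dq ∣ * (Dq * u)   ≡⟨ cong (_* (Dq * u)) (trans (ℚₚ.∣p*q∣≡∣p∣*∣q∣ (fromℤ z) (inv Dq)) (cong₂ _*_ ∣fromℤ∣ ∣invD∣)) ⟩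
    Z * inv Dq * (Dq * u)             ≡⟨ solve 4 (λ Z i D u → Z :* i :* (D :* u) := Z :* u :* (D :* i)) refl Z (inv Dq) Dq u ⟩
    Z * u * (Dq * inv Dq)             ≡⟨ cong (Z * u *_) (fromℤ-inverseʳ (1≤⇒≢0 (ℤ.+≤+ 1≤D))) ⟩
    Z * u * 1ℚ                        ≡⟨ ℚₚ.*-identityʳ _ ⟩
    Z * u                             ≡⟨ sym (fromℤ-pos-* ℤ.∣ z ∣ (suc N)) ⟩
    fromℤ (+ (ℤ.∣ z ∣ ℕ.* suc N))     ≤⟨ fromℤ-mono-≤ (ℤ.+≤+ ∣z∣u≤KD) ⟩
    fromℤ (+ (K ℕ.* D))               ≡⟨ fromℤ-pos-* K D ⟩
    Kq * Dq                           ≡⟨ sym (ℚₚ.*-identityʳ _) ⟩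
    Kq * Dq * 1ℚ                      ≡⟨ cong (Kq * Dq *_) (sym (1/[1+]-inverse N)) ⟩
    Kq * Dq * (u * 1/[1+ N ])         ≡⟨ solve 4 (λ K D u i → K :* D :* (u :* i) := K :* i :* (D :* u)) refl Kq Dq u 1/[1+ N ] ⟩
    Kq * 1/[1+ N ] * (Dq * u)         ∎)
    where
    open ℚₚ.≤-Reasoning
    Dq = fromℤ (+ D)
    u = fromℤ (+ suc N)
    Kq = fromℤ (+ K)
    Z = fromℤ (+ ℤ.∣ z ∣)
    ∣fromℤ∣ : ∣ fromℤ z ∣ ≡ Z
    ∣fromℤ∣ = trans (cong ∣_∣ (fromℤ≡mkℚ z)) (sym (fromℤ≡mkℚ (+ ℤ.∣ z ∣)))
    ∣invD∣ : ∣ inv Dq ∣ ≡ inv Dq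
    ∣invD∣ = ℚₚ.0≤p⇒∣p∣≡p (proj₁ (inv-fromℤ-bounds (+ D) 0 (ℤ.+≤+ 1≤D)))
    0<Dq*u : 0ℚ < Dq * u
    0<Dq*u = subst (_< Dq * u) (ℚₚ.*-zeroˡ u)
      (*-monoʳ-<-0< u (fromℤ-mono-< {+ 0} {+ suc N} (ℤ.+<+ (s≤s z≤n))) (fromℤ-mono-< {+ 0} {+ D} (ℤ.+<+ 1≤D)))

  τ≡1+N+y : ∀ a₀ y N → τ a₀ N ℤ.+ y ≡ + suc N ℤ.+ (y ℤ.- a₀)
  τ≡1+N+y a₀ y N = trans (regroup a₀ y (+ N)) (cong (ℤ._+ (y ℤ.- a₀)) (sym (ℤₚ.pos-+ 1 N)))
    where
    regroup : ∀ a₀ y N → ((+ 1 ℤ.- a₀) ℤ.+ N) ℤ.+ y ≡ (+ 1 ℤ.+ N) ℤ.+ (y ℤ.- a₀)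
    regroup = ℤ-Solver.solve-∀

  decayConstant : ℤ → ℤ → ℕ → ℕ → ℕ → ℕ
  decayConstant a₀ b n₂ n₃ s = (1 ℕ.+ ℤ.∣ + 0 ℤ.- a₀ ∣) ℕ.* pochBound (b ℤ.- a₀) s ℕ.* n₂ ! ℕ.* n₃ !

  ∣τ*pochℤ∣≤ : ∀ a₀ b s N →
    ℤ.∣ τ a₀ N ℤ.* pochℤ (τ a₀ N ℤ.+ b) s ∣ ℕ.≤ (1 ℕ.+ ℤ.∣ + 0 ℤ.- a₀ ∣) ℕ.* pochBound (b ℤ.- a₀) s ℕ.* suc N ^ suc s
  ∣τ*pochℤ∣≤ a₀ b s N = begin
    ℤ.∣ τ a₀ N ℤ.* pochℤ (τ a₀ N ℤ.+ b) s ∣               ≡⟨ ℤₚ.abs-* (τ a₀ N) _ ⟩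
    ℤ.∣ τ a₀ N ∣ ℕ.* ℤ.∣ pochℤ (τ a₀ N ℤ.+ b) s ∣         ≤⟨ ℕₚ.*-mono-≤ ∣τ∣≤ ∣pochℤ-τ∣≤ ⟩
    ((1 ℕ.+ ℤ.∣ + 0 ℤ.- a₀ ∣) ℕ.* suc N) ℕ.* (pochBound (b ℤ.- a₀) s ℕ.* suc N ^ s)
        ≡⟨ regroup (1 ℕ.+ ℤ.∣ + 0 ℤ.- a₀ ∣) (suc N) (pochBound (b ℤ.- a₀) s) (suc N ^ s) ⟩
    (1 ℕ.+ ℤ.∣ + 0 ℤ.- a₀ ∣) ℕ.* pochBound (b ℤ.- a₀) s ℕ.* suc N ^ suc s   ∎
    where
    open ℕₚ.≤-Reasoning
    τ≡τ+0 : τ a₀ N ≡ τ a₀ N ℤ.+ + 0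
    τ≡τ+0 = sym (ℤₚ.+-identityʳ (τ a₀ N))
    ∣τ∣≤ : ℤ.∣ τ a₀ N ∣ ℕ.≤ (1 ℕ.+ ℤ.∣ + 0 ℤ.- a₀ ∣) ℕ.* suc N
    ∣τ∣≤ = subst (λ w → ℤ.∣ w ∣ ℕ.≤ (1 ℕ.+ ℤ.∣ + 0 ℤ.- a₀ ∣) ℕ.* suc N) (sym (trans τ≡τ+0 (τ≡1+N+y a₀ (+ 0) N))) (∣u+y∣≤[1+∣y∣]*u N (+ 0 ℤ.- a₀))
    ∣pochℤ-τ∣≤ : ℤ.∣ pochℤ (τ a₀ N ℤ.+ b) s ∣ ℕ.≤ pochBound (b ℤ.- a₀) s ℕ.* suc N ^ s
    ∣pochℤ-τ∣≤ = subst (λ w → ℤ.∣ pochℤ w s ∣ ℕ.≤ pochBound (b ℤ.- a₀) s ℕ.* suc N ^ s) (sym (τ≡1+N+y a₀ b N)) (∣pochℤ∣≤ N (b ℤ.- a₀) s)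
    regroup : ∀ a u k p → (a ℕ.* u) ℕ.* (k ℕ.* p) ≡ a ℕ.* k ℕ.* (u ℕ.* p)
    regroup = ℕ-Solver.solve-∀

  τ*stage≡fraction : ∀ a₀ b a₂ a₃ n₂ n₃ s N → a₀ ℤ.≤ a₂ → a₀ ℤ.≤ a₃ →
    fromℤ (τ a₀ N) * (poch (τ a₀ N ℤ.+ b) s * (pochReciprocal a₂ n₂ (τ a₀ N) * pochReciprocal a₃ n₃ (τ a₀ N)))
      ≡ fromℤ (τ a₀ N ℤ.* pochℤ (τ a₀ N ℤ.+ b) s ℤ.* + (n₂ !) ℤ.* + (n₃ !))
        * inv (fromℤ (+ (pochℕ (suc N ℕ.+ ℤ.∣ a₂ ℤ.- a₀ ∣) (suc n₂) ℕ.* pochℕ (suc N ℕ.+ ℤ.∣ a₃ ℤ.- a₀ ∣) (suc n₃))))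
  τ*stage≡fraction a₀ b a₂ a₃ n₂ n₃ s N a₀≤a₂ a₀≤a₃ = begin
    fromℤ t * (poch (t ℤ.+ b) s * ((F₂ * inv (poch (t ℤ.+ a₂) (suc n₂))) * (F₃ * inv (poch (t ℤ.+ a₃) (suc n₃)))))
        ≡⟨ cong₂ (λ p q → fromℤ t * (p * ((F₂ * inv q) * (F₃ * inv (poch (t ℤ.+ a₃) (suc n₃))))))
                 (poch≡fromℤ-pochℤ (t ℤ.+ b) s) (poch-τ a₀ a₂ N (suc n₂) a₀≤a₂) ⟩
    fromℤ t * (fromℤ p * ((F₂ * inv (fromℤ (+ P₂))) * (F₃ * inv (poch (t ℤ.+ a₃) (suc n₃)))))
        ≡⟨ cong (λ q → fromℤ t * (fromℤ p * ((F₂ * inv (fromℤ (+ P₂))) * (F₃ * inv q)))) (poch-τ a₀ a₃ N (suc n₃) a₀≤a₃) ⟩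
    fromℤ t * (fromℤ p * ((F₂ * inv (fromℤ (+ P₂))) * (F₃ * inv (fromℤ (+ P₃)))))
        ≡⟨ solve 6 (λ a b c d e f → a :* (b :* ((c :* d) :* (e :* f))) := (((a :* b) :* c) :* e) :* (d :* f)) refl
                   (fromℤ t) (fromℤ p) F₂ (inv (fromℤ (+ P₂))) F₃ (inv (fromℤ (+ P₃))) ⟩
    (((fromℤ t * fromℤ p) * F₂) * F₃) * (inv (fromℤ (+ P₂)) * inv (fromℤ (+ P₃)))
        ≡⟨ cong₂ _*_ (sym (trans (fromℤ-* (t ℤ.* p ℤ.* + (n₂ !)) (+ (n₃ !)))
                                 (cong (_* F₃) (trans (fromℤ-* (t ℤ.* p) (+ (n₂ !))) (cong (_* F₂) (fromℤ-* t p))))))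
                     (sym (trans (cong inv (fromℤ-pos-* P₂ P₃)) (inv-* (fromℤ (+ P₂)) (fromℤ (+ P₃))))) ⟩
    fromℤ (t ℤ.* p ℤ.* + (n₂ !) ℤ.* + (n₃ !)) * inv (fromℤ (+ (P₂ ℕ.* P₃)))   ∎
    where
    open ≡-Reasoning
    t = τ a₀ N
    p = pochℤ (t ℤ.+ b) s
    P₂ = pochℕ (suc N ℕ.+ ℤ.∣ a₂ ℤ.- a₀ ∣) (suc n₂)
    P₃ = pochℕ (suc N ℕ.+ ℤ.∣ a₃ ℤ.- a₀ ∣) (suc n₃)
    F₂ = fromℤ (+ (n₂ !))
    F₃ = fromℤ (+ (n₃ !))

  -- At stage s the rational function t ↦ t (t+b)ₛ · n₂!/(t+a₂)ₙ₂₊₁ · n₃!/(t+a₃)ₙ₃₊₁ has degree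
  -- s + 1 - (n₂ + n₃ + 2) ≤ -1, hence decays like 1/N along t = τ a₀ N.
  τ*stage-bound : ∀ a₀ b a₂ a₃ n₂ n₃ s N → a₀ ℤ.≤ a₂ → a₀ ℤ.≤ a₃ → s ℕ.≤ n₂ ℕ.+ n₃ →
    ∣ fromℤ (τ a₀ N) * (poch (τ a₀ N ℤ.+ b) s * (pochReciprocal a₂ n₂ (τ a₀ N) * pochReciprocal a₃ n₃ (τ a₀ N))) ∣
      ≤ fromℤ (+ decayConstant a₀ b n₂ n₃ s) * 1/[1+ N ]
  τ*stage-bound a₀ b a₂ a₃ n₂ n₃ s N a₀≤a₂ a₀≤a₃ s≤n₂+n₃ =
    subst (λ w → ∣ w ∣ ≤ fromℤ (+ K) * 1/[1+ N ]) (sym (τ*stage≡fraction a₀ b a₂ a₃ n₂ n₃ s N a₀≤a₂ a₀≤a₃))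
      (∣z/D∣≤K/[1+N] z Dn K N 1≤Dn ∣z∣u≤KDn)
    where
    t = τ a₀ N
    u = suc N
    K = decayConstant a₀ b n₂ n₃ s
    Dn = pochℕ (u ℕ.+ ℤ.∣ a₂ ℤ.- a₀ ∣) (suc n₂) ℕ.* pochℕ (u ℕ.+ ℤ.∣ a₃ ℤ.- a₀ ∣) (suc n₃)
    z = t ℤ.* pochℤ (t ℤ.+ b) s ℤ.* + (n₂ !) ℤ.* + (n₃ !)
    u^[n₂+n₃+2]≤Dn : u ^ (suc n₂ ℕ.+ suc n₃) ℕ.≤ Dn
    u^[n₂+n₃+2]≤Dn = subst (ℕ._≤ Dn) (sym (ℕₚ.^-distribˡ-+-* u (suc n₂) (suc n₃)))
      (ℕₚ.*-mono-≤ (^≤pochℕ (suc n₂) (ℕₚ.m≤m+n u _)) (^≤pochℕ (suc n₃) (ℕₚ.m≤m+n u _)))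
    1≤Dn : 1 ℕ.≤ Dn
    1≤Dn = ℕₚ.≤-trans (ℕₚ.m^n>0 u (suc n₂ ℕ.+ suc n₃)) u^[n₂+n₃+2]≤Dn
    s+2≤n₂+n₃+2 : suc (suc s) ℕ.≤ suc n₂ ℕ.+ suc n₃
    s+2≤n₂+n₃+2 = subst (suc (suc s) ℕ.≤_) (sym (cong suc (ℕₚ.+-suc n₂ n₃))) (s≤s (s≤s s≤n₂+n₃))
    ∣z∣u≤KDn : ℤ.∣ z ∣ ℕ.* u ℕ.≤ K ℕ.* Dn
    ∣z∣u≤KDn = begin
      ℤ.∣ z ∣ ℕ.* u
          ≡⟨ cong (ℕ._* u) (trans (ℤₚ.abs-* (t ℤ.* pochℤ (t ℤ.+ b) s ℤ.* + (n₂ !)) (+ (n₃ !)))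
                                  (cong (ℕ._* (n₃ !)) (ℤₚ.abs-* (t ℤ.* pochℤ (t ℤ.+ b) s) (+ (n₂ !))))) ⟩
      ℤ.∣ t ℤ.* pochℤ (t ℤ.+ b) s ∣ ℕ.* n₂ ! ℕ.* n₃ ! ℕ.* u
          ≤⟨ ℕₚ.*-monoˡ-≤ u (ℕₚ.*-monoˡ-≤ (n₃ !) (ℕₚ.*-monoˡ-≤ (n₂ !) (∣τ*pochℤ∣≤ a₀ b s N))) ⟩
      A ℕ.* Kp ℕ.* u ^ suc s ℕ.* n₂ ! ℕ.* n₃ ! ℕ.* u
          ≡⟨ regroup A Kp (u ^ suc s) (n₂ !) (n₃ !) u ⟩
      K ℕ.* (u ℕ.* u ^ suc s)
          ≤⟨ ℕₚ.*-monoʳ-≤ K (ℕₚ.≤-trans (ℕₚ.^-monoʳ-≤ u s+2≤n₂+n₃+2) u^[n₂+n₃+2]≤Dn) ⟩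
      K ℕ.* Dn   ∎
      where
      open ℕₚ.≤-Reasoning
      A = 1 ℕ.+ ℤ.∣ + 0 ℤ.- a₀ ∣
      Kp = pochBound (b ℤ.- a₀) s
      regroup : ∀ a k p f g u → a ℕ.* k ℕ.* p ℕ.* f ℕ.* g ℕ.* u ≡ a ℕ.* k ℕ.* f ℕ.* g ℕ.* (u ℕ.* p)
      regroup = ℕ-Solver.solve-∀

  -- Finite sums and harmonic numbers

  sumℚ-cong : ∀ N {f g : ℕ → ℚ} → (∀ k → f k ≡ g k) → sumℚ N f ≡ sumℚ N g
  sumℚ-cong zero    f≗g = refl
  sumℚ-cong (suc N) f≗g = cong₂ _+_ (sumℚ-cong N f≗g) (f≗g N)

  sumℚ-+ : ∀ N (f g : ℕ → ℚ) → sumℚ N (λ k → f k + g k) ≡ sumℚ N f + sumℚ N g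
  sumℚ-+ zero    f g = refl
  sumℚ-+ (suc N) f g = trans (cong (_+ (f N + g N)) (sumℚ-+ N f g))
    (solve 4 (λ a b c d → (a :+ b) :+ (c :+ d) := (a :+ c) :+ (b :+ d)) refl (sumℚ N f) (sumℚ N g) (f N) (g N))

  sumℚ-* : ∀ N c (f : ℕ → ℚ) → sumℚ N (λ k → c * f k) ≡ c * sumℚ N f
  sumℚ-* zero    c f = sym (ℚₚ.*-zeroʳ c)
  sumℚ-* (suc N) c f = trans (cong (_+ (c * f N)) (sumℚ-* N c f)) (sym (ℚₚ.*-distribˡ-+ c (sumℚ N f) (f N)))

  sumℚ-vanishing : ∀ d (f : ℕ → ℚ) → (∀ k → k ℕ.< d → f k ≡ 0ℚ) → sumℚ d f ≡ 0ℚ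
  sumℚ-vanishing zero    f f≡0 = refl
  sumℚ-vanishing (suc d) f f≡0 =
    cong₂ _+_ (sumℚ-vanishing d f (λ k k<d → f≡0 k (ℕₚ.m≤n⇒m≤1+n k<d))) (f≡0 d ℕₚ.≤-refl)

  sumℚ-shift : ∀ (f : ℕ → ℚ) m N → sumℚ N (λ k → f (m ℕ.+ k)) ≡ sumℚ (m ℕ.+ N) f - sumℚ m f
  sumℚ-shift f m zero    = sym (trans (cong (λ w → sumℚ w f - sumℚ m f) (ℕₚ.+-identityʳ m)) (ℚₚ.+-inverseʳ (sumℚ m f)))
  sumℚ-shift f m (suc N) = begin
    sumℚ N (λ k → f (m ℕ.+ k)) + f (m ℕ.+ N)       ≡⟨ cong (_+ f (m ℕ.+ N)) (sumℚ-shift f m N) ⟩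
    (sumℚ (m ℕ.+ N) f - sumℚ m f) + f (m ℕ.+ N)   ≡⟨ solve 3 (λ a b c → (a :- b) :+ c := (a :+ c) :- b) refl (sumℚ (m ℕ.+ N) f) (sumℚ m f) (f (m ℕ.+ N)) ⟩
    sumℚ (suc (m ℕ.+ N)) f - sumℚ m f              ≡⟨ cong (λ w → sumℚ w f - sumℚ m f) (sym (ℕₚ.+-suc m N)) ⟩
    sumℚ (m ℕ.+ suc N) f - sumℚ m f                ∎
    where open ≡-Reasoning

  sumℚ-bounds : ∀ m (g : ℕ → ℚ) c → (∀ k → 0ℚ ≤ g k × g k ≤ c) → 0ℚ ≤ sumℚ m g × sumℚ m g ≤ fromℤ (+ m) * c
  sumℚ-bounds zero    g c g-bounds = ℚₚ.≤-refl , ℚₚ.≤-reflexive (sym (ℚₚ.*-zeroˡ c))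
  sumℚ-bounds (suc m) g c g-bounds =
    0≤+ (proj₁ ih) (proj₁ (g-bounds m)) ,
    ℚₚ.≤-trans (ℚₚ.+-mono-≤ (proj₂ ih) (proj₂ (g-bounds m))) (ℚₚ.≤-reflexive (sym [m+1]c≡mc+c))
    where
    ih : 0ℚ ≤ sumℚ m g × sumℚ m g ≤ fromℤ (+ m) * c
    ih = sumℚ-bounds m g c g-bounds
    [m+1]c≡mc+c : fromℤ (+ suc m) * c ≡ fromℤ (+ m) * c + c
    [m+1]c≡mc+c = trans (cong (_* c) (trans (cong fromℤ (trans (cong +_ (ℕₚ.+-comm 1 m)) (ℤₚ.pos-+ m 1))) (fromℤ-+ (+ m) (+ 1))))
                        (solve 2 (λ a c → (a :+ con 1ℚ) :* c := a :* c :+ c) refl (fromℤ (+ m)) c)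

  H₁ : ℕ → ℚ
  H₁ n = sumℚ n 1/[1+_]

  tail-bounds : ∀ (f : ℕ → ℚ) m N → (∀ j → N ℕ.≤ j → 0ℚ ≤ f j × f j ≤ 1/[1+ N ]) →
    0ℚ ≤ sumℚ (m ℕ.+ N) f - sumℚ N f × sumℚ (m ℕ.+ N) f - sumℚ N f ≤ fromℤ (+ m) * 1/[1+ N ]
  tail-bounds f m N f-bounds = subst (λ w → 0ℚ ≤ w × w ≤ fromℤ (+ m) * 1/[1+ N ]) tail≡
    (sumℚ-bounds m (λ k → f (N ℕ.+ k)) 1/[1+ N ] (λ k → f-bounds (N ℕ.+ k) (ℕₚ.m≤m+n N k)))
    where
    tail≡ : sumℚ m (λ k → f (N ℕ.+ k)) ≡ sumℚ (m ℕ.+ N) f - sumℚ N f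
    tail≡ = trans (sumℚ-shift f N m) (cong (λ w → sumℚ w f - sumℚ N f) (ℕₚ.+-comm N m))

  ∣H₁-tail∣≤ : ∀ m N → ∣ H₁ (m ℕ.+ N) - H₁ N ∣ ≤ fromℤ (+ m) * 1/[1+ N ]
  ∣H₁-tail∣≤ m N = 0≤⇒∣∣≤ (proj₁ bounds) (proj₂ bounds)
    where
    bounds : 0ℚ ≤ H₁ (m ℕ.+ N) - H₁ N × H₁ (m ℕ.+ N) - H₁ N ≤ fromℤ (+ m) * 1/[1+ N ]
    bounds = tail-bounds 1/[1+_] m N (λ j N≤j → inv-fromℤ-bounds (+ suc j) N (ℤ.+≤+ (s≤s N≤j)))

  ∣ζ2partial-tail∣≤ : ∀ m N → ∣ ζ2partial (m ℕ.+ N) - ζ2partial N ∣ ≤ fromℤ (+ m) * 1/[1+ N ]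
  ∣ζ2partial-tail∣≤ m N = 0≤⇒∣∣≤ (proj₁ bounds) (proj₂ bounds)
    where
    bounds : 0ℚ ≤ ζ2partial (m ℕ.+ N) - ζ2partial N × ζ2partial (m ℕ.+ N) - ζ2partial N ≤ fromℤ (+ m) * 1/[1+ N ]
    bounds = tail-bounds (λ j → inv (fromℤ (+ (suc j ℕ.* suc j)))) m N
      (λ j N≤j → inv-fromℤ-bounds (+ (suc j ℕ.* suc j)) N (ℤ.+≤+ (ℕₚ.≤-trans (s≤s N≤j) (ℕₚ.m≤m*n (suc j) (suc j)))))

  poleOffset : ℤ → Term → ℕ
  poleOffset a₀ x = ℤ.∣ pole x ℤ.- a₀ ∣

  harmonicPart : Term → ℕ → ℚ
  harmonicPart x n = doubleCoeff x * ζ2partial n + residue x * H₁ n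

  evalTerm-τ : ∀ a₀ k x → a₀ ℤ.≤ pole x →
    evalTerm (τ a₀ k) x ≡ doubleCoeff x * inv (fromℤ (+ (suc (poleOffset a₀ x ℕ.+ k) ℕ.* suc (poleOffset a₀ x ℕ.+ k))))
                          + residue x * 1/[1+ poleOffset a₀ x ℕ.+ k ]
  evalTerm-τ a₀ k (simple c p) a₀≤p = begin
    c * inv (fromℤ (τ a₀ k ℤ.+ p))       ≡⟨ cong (λ w → c * inv (fromℤ w)) (τ+p≡1+j a₀≤p) ⟩
    c * 1/[1+ j ]                         ≡⟨ solve 3 (λ c i i² → c :* i := con 0ℚ :* i² :+ c :* i) refl c 1/[1+ j ] (inv (fromℤ (+ (suc j ℕ.* suc j)))) ⟩
    0ℚ * inv (fromℤ (+ (suc j ℕ.* suc j))) + c * 1/[1+ j ]   ∎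
    where
    open ≡-Reasoning
    j = poleOffset a₀ (simple c p) ℕ.+ k
    τ+p≡1+j : a₀ ℤ.≤ p → τ a₀ k ℤ.+ p ≡ + suc j
    τ+p≡1+j a₀≤p = trans (τ+a≡pos a₀ p k a₀≤p) (cong (λ w → + suc w) (ℕₚ.+-comm k _))
  evalTerm-τ a₀ k (double c p) a₀≤p = begin
    c * (inv (fromℤ (τ a₀ k ℤ.+ p)) * inv (fromℤ (τ a₀ k ℤ.+ p)))
        ≡⟨ cong (λ w → c * (inv (fromℤ w) * inv (fromℤ w))) (trans (τ+a≡pos a₀ p k a₀≤p) (cong (λ w → + suc w) (ℕₚ.+-comm k _))) ⟩
    c * (1/[1+ j ] * 1/[1+ j ])
        ≡⟨ cong (c *_) (sym (trans (cong inv (fromℤ-pos-* (suc j) (suc j))) (inv-* (fromℤ (+ suc j)) (fromℤ (+ suc j))))) ⟩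
    c * inv (fromℤ (+ (suc j ℕ.* suc j)))
        ≡⟨ solve 3 (λ c i² i → c :* i² := c :* i² :+ con 0ℚ :* i) refl c (inv (fromℤ (+ (suc j ℕ.* suc j)))) 1/[1+ j ] ⟩
    c * inv (fromℤ (+ (suc j ℕ.* suc j))) + 0ℚ * 1/[1+ j ]   ∎
    where
    open ≡-Reasoning
    j = poleOffset a₀ (double c p) ℕ.+ k

  sumTerm-τ : ∀ a₀ N x → a₀ ℤ.≤ pole x →
    sumℚ N (λ k → evalTerm (τ a₀ k) x) ≡ harmonicPart x (poleOffset a₀ x ℕ.+ N) - harmonicPart x (poleOffset a₀ x)
  sumTerm-τ a₀ N x a₀≤p = begin
    sumℚ N (λ k → evalTerm (τ a₀ k) x)
        ≡⟨ sumℚ-cong N (λ k → evalTerm-τ a₀ k x a₀≤p) ⟩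
    sumℚ N (λ k → α * f₂ (m ℕ.+ k) + β * 1/[1+ m ℕ.+ k ])
        ≡⟨ sumℚ-+ N _ _ ⟩
    sumℚ N (λ k → α * f₂ (m ℕ.+ k)) + sumℚ N (λ k → β * 1/[1+ m ℕ.+ k ])
        ≡⟨ cong₂ _+_ (sumℚ-* N α (λ k → f₂ (m ℕ.+ k))) (sumℚ-* N β (λ k → 1/[1+ m ℕ.+ k ])) ⟩
    α * sumℚ N (λ k → f₂ (m ℕ.+ k)) + β * sumℚ N (λ k → 1/[1+ m ℕ.+ k ])
        ≡⟨ cong₂ (λ u v → α * u + β * v) (sumℚ-shift f₂ m N) (sumℚ-shift 1/[1+_] m N) ⟩
    α * (ζ2partial (m ℕ.+ N) - ζ2partial m) + β * (H₁ (m ℕ.+ N) - H₁ m)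
        ≡⟨ solve 6 (λ a b p q r s → a :* (p :- q) :+ b :* (r :- s) := (a :* p :+ b :* r) :- (a :* q :+ b :* s)) refl
                 α β (ζ2partial (m ℕ.+ N)) (ζ2partial m) (H₁ (m ℕ.+ N)) (H₁ m) ⟩
    harmonicPart x (m ℕ.+ N) - harmonicPart x m   ∎
    where
    open ≡-Reasoning
    m = poleOffset a₀ x
    α = doubleCoeff x
    β = residue x
    f₂ = λ j → inv (fromℤ (+ (suc j ℕ.* suc j)))

  shiftedHarmonic : ℤ → List Term → ℕ → ℚ
  shiftedHarmonic a₀ []      n = 0ℚ
  shiftedHarmonic a₀ (x ∷ L) n = harmonicPart x (poleOffset a₀ x ℕ.+ n) + shiftedHarmonic a₀ L n

  sumTerms-τ : ∀ a₀ N L → All (λ x → a₀ ℤ.≤ pole x) L →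
    sumℚ N (λ k → evalTerms (τ a₀ k) L) ≡ shiftedHarmonic a₀ L N - shiftedHarmonic a₀ L 0
  sumTerms-τ a₀ N []      []            = sumℚ-vanishing N _ (λ _ _ → refl)
  sumTerms-τ a₀ N (x ∷ L) (a₀≤x ∷ a₀≤L) = begin
    sumℚ N (λ k → evalTerm (τ a₀ k) x + evalTerms (τ a₀ k) L)
        ≡⟨ sumℚ-+ N _ _ ⟩
    sumℚ N (λ k → evalTerm (τ a₀ k) x) + sumℚ N (λ k → evalTerms (τ a₀ k) L)
        ≡⟨ cong₂ _+_ (sumTerm-τ a₀ N x a₀≤x) (sumTerms-τ a₀ N L a₀≤L) ⟩
    (harmonicPart x (m ℕ.+ N) - harmonicPart x m) + (shiftedHarmonic a₀ L N - shiftedHarmonic a₀ L 0)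
        ≡⟨ cong (λ w → (harmonicPart x (m ℕ.+ N) - harmonicPart x w) + (shiftedHarmonic a₀ L N - shiftedHarmonic a₀ L 0)) (sym (ℕₚ.+-identityʳ m)) ⟩
    (harmonicPart x (m ℕ.+ N) - harmonicPart x (m ℕ.+ 0)) + (shiftedHarmonic a₀ L N - shiftedHarmonic a₀ L 0)
        ≡⟨ solve 4 (λ a b c d → (a :- b) :+ (c :- d) := (a :+ c) :- (b :+ d)) refl
                 (harmonicPart x (m ℕ.+ N)) (harmonicPart x (m ℕ.+ 0)) (shiftedHarmonic a₀ L N) (shiftedHarmonic a₀ L 0) ⟩
    shiftedHarmonic a₀ (x ∷ L) N - shiftedHarmonic a₀ (x ∷ L) 0   ∎
    where
    open ≡-Reasoning
    m = poleOffset a₀ x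

  harmonicDefect : ℤ → List Term → ℕ → ℚ
  harmonicDefect a₀ []      N = 0ℚ
  harmonicDefect a₀ (x ∷ L) N = (harmonicPart x (poleOffset a₀ x ℕ.+ N) - harmonicPart x N) + harmonicDefect a₀ L N

  shiftedHarmonic-split : ∀ a₀ L N →
    shiftedHarmonic a₀ L N ≡ harmonicDefect a₀ L N + (doubleCoeffSum L * ζ2partial N + residueSum L * H₁ N)
  shiftedHarmonic-split a₀ []      N =
    sym (trans (ℚₚ.+-identityˡ _) (solve 2 (λ a b → con 0ℚ :* a :+ con 0ℚ :* b := con 0ℚ) refl (ζ2partial N) (H₁ N)))
  shiftedHarmonic-split a₀ (x ∷ L) N =
    trans (cong (_+_ (harmonicPart x (poleOffset a₀ x ℕ.+ N))) (shiftedHarmonic-split a₀ L N))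
      (solve 8 (λ h d α β s₂ s₁ H₂ H₁ → h :+ (d :+ (s₂ :* H₂ :+ s₁ :* H₁)) := (h :- (α :* H₂ :+ β :* H₁)) :+ d :+ ((α :+ s₂) :* H₂ :+ (β :+ s₁) :* H₁)) refl
         (harmonicPart x (poleOffset a₀ x ℕ.+ N)) (harmonicDefect a₀ L N) (doubleCoeff x) (residue x)
         (doubleCoeffSum L) (residueSum L) (ζ2partial N) (H₁ N))

  defectBound : ℤ → List Term → ℚ
  defectBound a₀ []      = 0ℚ
  defectBound a₀ (x ∷ L) = (∣ doubleCoeff x ∣ + ∣ residue x ∣) * fromℤ (+ poleOffset a₀ x) + defectBound a₀ L

  defectBound-nonNeg : ∀ a₀ L → 0ℚ ≤ defectBound a₀ L
  defectBound-nonNeg a₀ []      = ℚₚ.≤-refl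
  defectBound-nonNeg a₀ (x ∷ L) =
    0≤+ (0≤* (0≤+ (ℚₚ.0≤∣p∣ (doubleCoeff x)) (ℚₚ.0≤∣p∣ (residue x))) (fromℤ-nonNeg (poleOffset a₀ x))) (defectBound-nonNeg a₀ L)

  ∣harmonicPart-tail∣≤ : ∀ x m N →
    ∣ harmonicPart x (m ℕ.+ N) - harmonicPart x N ∣ ≤ (∣ doubleCoeff x ∣ + ∣ residue x ∣) * fromℤ (+ m) * 1/[1+ N ]
  ∣harmonicPart-tail∣≤ x m N = begin
    ∣ harmonicPart x (m ℕ.+ N) - harmonicPart x N ∣
        ≡⟨ cong ∣_∣ (solve 6 (λ α β p q r s → (α :* p :+ β :* r) :- (α :* q :+ β :* s) := α :* (p :- q) :+ β :* (r :- s)) refl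
                           α β (ζ2partial (m ℕ.+ N)) (ζ2partial N) (H₁ (m ℕ.+ N)) (H₁ N)) ⟩
    ∣ α * d₂ + β * d₁ ∣                     ≤⟨ ℚₚ.∣p+q∣≤∣p∣+∣q∣ (α * d₂) (β * d₁) ⟩
    ∣ α * d₂ ∣ + ∣ β * d₁ ∣                 ≡⟨ cong₂ _+_ (ℚₚ.∣p*q∣≡∣p∣*∣q∣ α d₂) (ℚₚ.∣p*q∣≡∣p∣*∣q∣ β d₁) ⟩
    ∣ α ∣ * ∣ d₂ ∣ + ∣ β ∣ * ∣ d₁ ∣         ≤⟨ ℚₚ.+-mono-≤ (*-monoˡ-≤-0≤ ∣ α ∣ (ℚₚ.0≤∣p∣ α) (∣ζ2partial-tail∣≤ m N))
                                                            (*-monoˡ-≤-0≤ ∣ β ∣ (ℚₚ.0≤∣p∣ β) (∣H₁-tail∣≤ m N)) ⟩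
    ∣ α ∣ * (M * 1/[1+ N ]) + ∣ β ∣ * (M * 1/[1+ N ])
        ≡⟨ solve 4 (λ a b m i → a :* (m :* i) :+ b :* (m :* i) := (a :+ b) :* m :* i) refl ∣ α ∣ ∣ β ∣ M 1/[1+ N ] ⟩
    (∣ α ∣ + ∣ β ∣) * M * 1/[1+ N ]         ∎
    where
    open ℚₚ.≤-Reasoning
    α = doubleCoeff x
    β = residue x
    M = fromℤ (+ m)
    d₂ = ζ2partial (m ℕ.+ N) - ζ2partial N
    d₁ = H₁ (m ℕ.+ N) - H₁ N

  ∣harmonicDefect∣≤ : ∀ a₀ L N → ∣ harmonicDefect a₀ L N ∣ ≤ defectBound a₀ L * 1/[1+ N ]
  ∣harmonicDefect∣≤ a₀ []      N = ℚₚ.≤-reflexive (sym (ℚₚ.*-zeroˡ 1/[1+ N ]))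
  ∣harmonicDefect∣≤ a₀ (x ∷ L) N = ℚₚ.≤-trans (ℚₚ.∣p+q∣≤∣p∣+∣q∣ (harmonicPart x (poleOffset a₀ x ℕ.+ N) - harmonicPart x N) (harmonicDefect a₀ L N))
    (ℚₚ.≤-trans (ℚₚ.+-mono-≤ (∣harmonicPart-tail∣≤ x (poleOffset a₀ x) N) (∣harmonicDefect∣≤ a₀ L N))
                (ℚₚ.≤-reflexive (sym (ℚₚ.*-distribʳ-+ 1/[1+ N ] ((∣ doubleCoeff x ∣ + ∣ residue x ∣) * fromℤ (+ poleOffset a₀ x)) (defectBound a₀ L)))))

  -- Integrality

  j∣D : ∀ j n → 1 ℕ.≤ j → j ℕ.≤ n → j ∣ D n
  j∣D (suc j) zero    _   ()
  j∣D j       (suc n) 1≤j j≤1+n with j ℕₚ.≟ suc n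
  ... | yes refl = m∣lcm[m,n] (suc n) (D n)
  ... | no  j≢1+n = ℕ∣.∣-trans (j∣D j n 1≤j (ℕₚ.≤-pred (ℕₚ.≤∧≢⇒< j≤1+n j≢1+n))) (n∣lcm[m,n] (suc n) (D n))

  D-mono-∣ : ∀ {m n} → m ℕ.≤ n → D m ∣ D n
  D-mono-∣ {m} {zero}  z≤n = ℕ∣.∣-refl
  D-mono-∣ {m} {suc n} m≤1+n with m ℕₚ.≟ suc n
  ... | yes refl  = ℕ∣.∣-refl
  ... | no m≢1+n = ℕ∣.∣-trans (D-mono-∣ (ℕₚ.≤-pred (ℕₚ.≤∧≢⇒< m≤1+n m≢1+n))) (n∣lcm[m,n] (suc n) (D n))

  IsInt-∣-scale : ∀ {d e} q → d ∣ e → IsInt (fromℤ (+ d) * q) → IsInt (fromℤ (+ e) * q)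
  IsInt-∣-scale {d} q (divides k refl) dq∈ℤ =
    subst IsInt (trans (sym (ℚₚ.*-assoc (fromℤ (+ k)) (fromℤ (+ d)) q)) (cong (_* q) (sym (fromℤ-pos-* k d))))
          (IsInt-* (IsInt-fromℤ (+ k)) dq∈ℤ)

  record DIntegral (n : ℕ) (q : ℚ) : Set where
    constructor D-integral
    field integral : IsInt (fromℤ (+ D n) * q)
  open DIntegral public

  DIntegral-+ : ∀ {n p q} → DIntegral n p → DIntegral n q → DIntegral n (p + q)
  DIntegral-+ {n} {p} {q} (D-integral p∈) (D-integral q∈) =
    D-integral (subst IsInt (sym (ℚₚ.*-distribˡ-+ (fromℤ (+ D n)) p q)) (IsInt-+ p∈ q∈))

  DIntegral-*ˡ : ∀ {n a q} → IsInt a → DIntegral n q → DIntegral n (a * q)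
  DIntegral-*ˡ {n} {a} {q} a∈ℤ (D-integral q∈) =
    D-integral (subst IsInt (solve 3 (λ a d q → a :* (d :* q) := d :* (a :* q)) refl a (fromℤ (+ D n)) q) (IsInt-* a∈ℤ q∈))

  DIntegral-*ʳ : ∀ {n a q} → IsInt a → DIntegral n q → DIntegral n (q * a)
  DIntegral-*ʳ {n} {a} {q} a∈ℤ q∈ = subst (DIntegral n) (ℚₚ.*-comm a q) (DIntegral-*ˡ a∈ℤ q∈)

  DIntegral-mono : ∀ {m n q} → m ℕ.≤ n → DIntegral m q → DIntegral n q
  DIntegral-mono {q = q} m≤n (D-integral q∈) = D-integral (IsInt-∣-scale q (D-mono-∣ m≤n) q∈)

  DIntegral-1/ : ∀ j n → 1 ℕ.≤ j → j ℕ.≤ n → DIntegral n (inv (fromℤ (+ j)))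
  DIntegral-1/ j n 1≤j j≤n with j∣D j n 1≤j j≤n
  ... | divides k D≡kj = D-integral (+ k , (begin
    fromℤ (+ k)                                       ≡⟨ sym (ℚₚ.*-identityʳ (fromℤ (+ k))) ⟩
    fromℤ (+ k) * 1ℚ                                  ≡⟨ cong (fromℤ (+ k) *_) (sym (fromℤ-inverseʳ (1≤⇒≢0 (ℤ.+≤+ 1≤j)))) ⟩
    fromℤ (+ k) * (fromℤ (+ j) * inv (fromℤ (+ j)))   ≡⟨ sym (ℚₚ.*-assoc (fromℤ (+ k)) _ _) ⟩
    fromℤ (+ k) * fromℤ (+ j) * inv (fromℤ (+ j))     ≡⟨ cong (_* inv (fromℤ (+ j))) (sym (trans (cong (λ w → fromℤ (+ w)) D≡kj) (fromℤ-pos-* k j))) ⟩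
    fromℤ (+ D n) * inv (fromℤ (+ j))                 ∎))
    where open ≡-Reasoning

  DIntegral-inv : ∀ z n → z ≢ + 0 → ℤ.∣ z ∣ ℕ.≤ n → DIntegral n (inv (fromℤ z))
  DIntegral-inv (+ zero)  n z≢0 _ = ⊥-elim (z≢0 refl)
  DIntegral-inv (+ suc k) n _   ∣z∣≤n = DIntegral-1/ (suc k) n (s≤s z≤n) ∣z∣≤n
  DIntegral-inv -[1+ k ]  n _   ∣z∣≤n =
    subst (DIntegral n) (sym (trans (cong inv (fromℤ-neg (+ suc k))) (inv-neg (fromℤ (+ suc k)))))
      (D-integral (subst IsInt (ℚₚ.neg-distribʳ-* (fromℤ (+ D n)) (inv (fromℤ (+ suc k))))
        (IsInt-neg (integral (DIntegral-1/ (suc k) n (s≤s z≤n) ∣z∣≤n)))))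

  DIntegral-H₁ : ∀ m n → m ℕ.≤ n → DIntegral n (H₁ m)
  DIntegral-H₁ zero    n _     = D-integral (+ 0 , sym (ℚₚ.*-zeroʳ (fromℤ (+ D n))))
  DIntegral-H₁ (suc m) n 1+m≤n =
    DIntegral-+ (DIntegral-H₁ m n (ℕₚ.≤-trans (ℕₚ.n≤1+n m) 1+m≤n)) (DIntegral-1/ (suc m) n (s≤s z≤n) 1+m≤n)

  D²-ζ2partial : ∀ n → IsInt (fromℤ (+ D n) * (fromℤ (+ D n) * ζ2partial n))
  D²-ζ2partial zero    = + 0 , sym (trans (cong (fromℤ (+ 1) *_) (ℚₚ.*-zeroʳ (fromℤ (+ 1)))) (ℚₚ.*-zeroʳ (fromℤ (+ 1))))
  D²-ζ2partial (suc n) = subst IsInt (sym expand) (IsInt-+ Dₙ₊₁²ζ∈ℤ (IsInt-* Dₙ₊₁i∈ℤ Dₙ₊₁i∈ℤ))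
    where
    Dₙ = fromℤ (+ D n)
    Dₙ₊₁ = fromℤ (+ D (suc n))
    i = 1/[1+ n ]
    Dₙ₊₁i∈ℤ : IsInt (Dₙ₊₁ * i)
    Dₙ₊₁i∈ℤ = integral (DIntegral-1/ (suc n) (suc n) (s≤s z≤n) ℕₚ.≤-refl)
    Dₙ∣Dₙ₊₁ : D n ∣ D (suc n)
    Dₙ∣Dₙ₊₁ = n∣lcm[m,n] (suc n) (D n)
    Dₙ₊₁²ζ∈ℤ : IsInt (Dₙ₊₁ * (Dₙ₊₁ * ζ2partial n))
    Dₙ₊₁²ζ∈ℤ = IsInt-∣-scale (Dₙ₊₁ * ζ2partial n) Dₙ∣Dₙ₊₁
      (subst IsInt (solve 3 (λ a b q → b :* (a :* q) := a :* (b :* q)) refl Dₙ Dₙ₊₁ (ζ2partial n))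
        (IsInt-∣-scale (Dₙ * ζ2partial n) Dₙ∣Dₙ₊₁ (D²-ζ2partial n)))
    expand : Dₙ₊₁ * (Dₙ₊₁ * (ζ2partial n + inv (fromℤ (+ (suc n ℕ.* suc n))))) ≡ Dₙ₊₁ * (Dₙ₊₁ * ζ2partial n) + (Dₙ₊₁ * i) * (Dₙ₊₁ * i)
    expand = begin
      Dₙ₊₁ * (Dₙ₊₁ * (ζ2partial n + inv (fromℤ (+ (suc n ℕ.* suc n)))))
          ≡⟨ cong (λ w → Dₙ₊₁ * (Dₙ₊₁ * (ζ2partial n + w))) (trans (cong inv (fromℤ-pos-* (suc n) (suc n))) (inv-* (fromℤ (+ suc n)) (fromℤ (+ suc n)))) ⟩
      Dₙ₊₁ * (Dₙ₊₁ * (ζ2partial n + i * i))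
          ≡⟨ solve 3 (λ d h i → d :* (d :* (h :+ i :* i)) := d :* (d :* h) :+ (d :* i) :* (d :* i)) refl Dₙ₊₁ (ζ2partial n) i ⟩
      Dₙ₊₁ * (Dₙ₊₁ * ζ2partial n) + (Dₙ₊₁ * i) * (Dₙ₊₁ * i)   ∎
      where open ≡-Reasoning

  DIntegral-evalSimple : ∀ n L → All (IntegralWithPoleIn (+ 1) (+ n)) L → DIntegral n (evalSimple (+ 0) L)
  DIntegral-evalSimple n []            []                         = D-integral (+ 0 , sym (ℚₚ.*-zeroʳ (fromℤ (+ D n))))
  DIntegral-evalSimple n ((c , k) ∷ L) ((c∈ℤ , 1≤k , k≤n) ∷ L-ok) =
    DIntegral-+ (DIntegral-*ˡ c∈ℤ (subst (λ w → DIntegral n (inv (fromℤ w))) (sym (ℤₚ.+-identityˡ k))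
                                         (DIntegral-inv k n (1≤⇒≢0 1≤k) (∣k∣≤n 1≤k k≤n))))
                (DIntegral-evalSimple n L L-ok)
    where
    ∣k∣≤n : ∀ {k} → + 1 ℤ.≤ k → k ℤ.≤ + n → ℤ.∣ k ∣ ℕ.≤ n
    ∣k∣≤n {+ _} _ (ℤ.+≤+ k≤n) = k≤n

  -- i! j! / (i+j+1)! is the value at t = 0 of pochFractions i (j+1), an integer combination of
  -- 1/(j+1), …, 1/(i+j+1).
  i!j!/[i+j+1]!-DIntegral : ∀ i j → DIntegral (suc (i ℕ.+ j)) (fromℤ (+ (i !)) * fromℤ (+ (j !)) * inv (fromℤ (+ (suc (i ℕ.+ j) !))))
  i!j!/[i+j+1]!-DIntegral i j = subst (DIntegral (suc (i ℕ.+ j))) (sym value)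
    (DIntegral-evalSimple (suc (i ℕ.+ j)) (pochFractions i (+ suc j)) (All.map widen (pochFractions-All i (+ suc j))))
    where
    P = pochℕ (suc j) (suc i)
    Fi = fromℤ (+ (i !))
    Fj = fromℤ (+ (j !))
    P*j!≡[i+j+1]! : P ℕ.* j ! ≡ suc (i ℕ.+ j) !
    P*j!≡[i+j+1]! = trans (pochℕ*!≡! j (suc i)) (cong _! (trans (ℕₚ.+-suc j i) (cong suc (ℕₚ.+-comm j i))))
    widen : ∀ {x} → IntegralWithPoleIn (+ suc j) (+ suc j ℤ.+ + i) x → IntegralWithPoleIn (+ 1) (+ suc (i ℕ.+ j)) x
    widen {x} (c∈ℤ , 1+j≤k , k≤1+j+i) =
      c∈ℤ , ℤₚ.≤-trans (ℤ.+≤+ (s≤s z≤n)) 1+j≤k , subst (proj₂ x ℤ.≤_) (cong (λ w → + suc w) (ℕₚ.+-comm j i)) k≤1+j+i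
    value : Fi * Fj * inv (fromℤ (+ (suc (i ℕ.+ j) !))) ≡ evalSimple (+ 0) (pochFractions i (+ suc j))
    value = begin
      Fi * Fj * inv (fromℤ (+ (suc (i ℕ.+ j) !)))       ≡⟨ cong (λ w → Fi * Fj * inv (fromℤ (+ w))) (sym P*j!≡[i+j+1]!) ⟩
      Fi * Fj * inv (fromℤ (+ (P ℕ.* j !)))             ≡⟨ cong (λ w → Fi * Fj * inv w) (fromℤ-pos-* P (j !)) ⟩
      Fi * Fj * inv (fromℤ (+ P) * Fj)                  ≡⟨ cong (Fi * Fj *_) (inv-* (fromℤ (+ P)) Fj) ⟩
      Fi * Fj * (inv (fromℤ (+ P)) * inv Fj)            ≡⟨ solve 4 (λ a b c d → a :* b :* (c :* d) := a :* c :* (b :* d)) refl Fi Fj (inv (fromℤ (+ P))) (inv Fj) ⟩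
      Fi * inv (fromℤ (+ P)) * (Fj * inv Fj)            ≡⟨ cong (Fi * inv (fromℤ (+ P)) *_) (fromℤ-inverseʳ (1≤⇒≢0 (ℤ.+≤+ (ℕₚ.1≤n! j)))) ⟩
      Fi * inv (fromℤ (+ P)) * 1ℚ                       ≡⟨ ℚₚ.*-identityʳ _ ⟩
      Fi * inv (fromℤ (+ P))                            ≡⟨ cong (λ w → Fi * inv w) (sym (trans (poch≡fromℤ-pochℤ (+ suc j) (suc i)) (cong fromℤ (pochℤ-pos (suc j) (suc i))))) ⟩
      pochReciprocal (+ suc j) i (+ 0)                  ≡⟨ sym (pochFractions-eval i (+ suc j) (+ 0) (ℤ.+≤+ (s≤s z≤n))) ⟩
      evalSimple (+ 0) (pochFractions i (+ suc j))      ∎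
      where open ≡-Reasoning

  -- At the pole t = -k the factors t + b₁ + r (r < s) of the first s stages contribute (b₁ - k)ₛ;
  -- a simple term split off a double term at stage i misses exactly the factor with r = i.
  CoeffShape : ℤ → ℕ → ℤ → ℕ → Term → Set
  CoeffShape b₁ M cap s (simple c k) =
    (Σ ℚ λ β₀ → DIntegral M β₀ × c ≡ β₀ * poch (b₁ ℤ.- k) s) ⊎
    (Σ ℚ λ α₀ → Σ ℕ λ i → Σ ℕ λ j → IsInt α₀ × suc (i ℕ.+ j) ≡ s ×
       c ≡ α₀ * (poch (b₁ ℤ.- k) i * poch ((b₁ ℤ.- k) ℤ.+ + suc i) j))
  CoeffShape b₁ M cap s (double c k) = Σ ℚ λ α₀ → IsInt α₀ × c ≡ α₀ * poch (b₁ ℤ.- k) s × k ℤ.< cap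

  poch-absorb : ∀ b₁ k s a → fromℤ ((b₁ ℤ.+ + s) ℤ.- k) * (a * poch (b₁ ℤ.- k) s) ≡ a * poch (b₁ ℤ.- k) (suc s)
  poch-absorb b₁ k s a = begin
    fromℤ ((b₁ ℤ.+ + s) ℤ.- k) * (a * poch y s)    ≡⟨ cong (λ w → fromℤ w * (a * poch y s)) (regroup b₁ k (+ s)) ⟩
    fromℤ (y ℤ.+ + s) * (a * poch y s)             ≡⟨ solve 3 (λ f a p → f :* (a :* p) := a :* (p :* f)) refl (fromℤ (y ℤ.+ + s)) a (poch y s) ⟩
    a * (poch y s * fromℤ (y ℤ.+ + s))             ≡⟨ cong (a *_) (sym (poch-suc y s)) ⟩
    a * poch y (suc s)                             ∎
    where
    open ≡-Reasoning
    y = b₁ ℤ.- k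
    regroup : ∀ b k s → (b ℤ.+ s) ℤ.- k ≡ (b ℤ.- k) ℤ.+ s
    regroup = ℤ-Solver.solve-∀

  mulLinearTerm-shape : ∀ b₁ M cap s x → CoeffShape b₁ M cap s x →
    All (CoeffShape b₁ M cap (suc s)) (mulLinearTerm (b₁ ℤ.+ + s) x)
  mulLinearTerm-shape b₁ M cap s (simple c k) (inj₁ (β₀ , β₀∈ , refl)) =
    inj₁ (β₀ , β₀∈ , poch-absorb b₁ k s β₀) ∷ []
  mulLinearTerm-shape b₁ M cap .(suc (i ℕ.+ j)) (simple c k) (inj₂ (α₀ , i , j , α₀∈ℤ , refl , refl)) =
    inj₂ (α₀ , i , suc j , α₀∈ℤ , cong suc (ℕₚ.+-suc i j) , eq) ∷ []
    where
    y = b₁ ℤ.- k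
    z = y ℤ.+ + suc i
    b₁+s-k≡z+j : (b₁ ℤ.+ + suc (i ℕ.+ j)) ℤ.- k ≡ z ℤ.+ + j
    b₁+s-k≡z+j = trans (cong (λ w → (b₁ ℤ.+ w) ℤ.- k) (ℤₚ.pos-+ (suc i) j)) (regroup b₁ k (+ suc i) (+ j))
      where
      regroup : ∀ b k i j → (b ℤ.+ (i ℤ.+ j)) ℤ.- k ≡ ((b ℤ.- k) ℤ.+ i) ℤ.+ j
      regroup = ℤ-Solver.solve-∀
    eq : fromℤ ((b₁ ℤ.+ + suc (i ℕ.+ j)) ℤ.- k) * (α₀ * (poch y i * poch z j)) ≡ α₀ * (poch y i * poch z (suc j))
    eq = begin
      fromℤ ((b₁ ℤ.+ + suc (i ℕ.+ j)) ℤ.- k) * (α₀ * (poch y i * poch z j))   ≡⟨ cong (λ w → fromℤ w * (α₀ * (poch y i * poch z j))) b₁+s-k≡z+j ⟩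
      fromℤ (z ℤ.+ + j) * (α₀ * (poch y i * poch z j))                       ≡⟨ solve 4 (λ f a p q → f :* (a :* (p :* q)) := a :* (p :* (q :* f))) refl (fromℤ (z ℤ.+ + j)) α₀ (poch y i) (poch z j) ⟩
      α₀ * (poch y i * (poch z j * fromℤ (z ℤ.+ + j)))                       ≡⟨ cong (λ w → α₀ * (poch y i * w)) (sym (poch-suc z j)) ⟩
      α₀ * (poch y i * poch z (suc j))                                       ∎
      where open ≡-Reasoning
  mulLinearTerm-shape b₁ M cap s (double c k) (α₀ , α₀∈ℤ , refl , k<cap) =
    inj₂ (α₀ , s , 0 , α₀∈ℤ , cong suc (ℕₚ.+-identityʳ s) , sym (cong (α₀ *_) (ℚₚ.*-identityʳ (poch (b₁ ℤ.- k) s)))) ∷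
    (α₀ , α₀∈ℤ , poch-absorb b₁ k s α₀ , k<cap) ∷ []

  multiplySimple-shape : ∀ b₁ M cap lo₂ hi₂ lo₃ hi₃ →
    (∀ p q → lo₂ ℤ.≤ p → p ℤ.≤ hi₂ → lo₃ ℤ.≤ q → q ℤ.≤ hi₃ → ℤ.∣ q ℤ.- p ∣ ℕ.≤ M) →
    (∀ p → p ℤ.≤ hi₂ → p ℤ.≤ hi₃ → p ℤ.< cap) →
    ∀ x y → IntegralWithPoleIn lo₂ hi₂ x → IntegralWithPoleIn lo₃ hi₃ y → All (CoeffShape b₁ M cap 0) (multiplySimple x y)
  multiplySimple-shape b₁ M cap lo₂ hi₂ lo₃ hi₃ ∣q-p∣≤M below-cap (c , p) (d , q) (c∈ℤ , lo₂≤p , p≤hi₂) (d∈ℤ , lo₃≤q , q≤hi₃) =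
    shape (p ℤ.≟ q)
    where
    ∣q-p∣≤ : ℤ.∣ q ℤ.- p ∣ ℕ.≤ M
    ∣q-p∣≤ = ∣q-p∣≤M p q lo₂≤p p≤hi₂ lo₃≤q q≤hi₃
    shape : (p≟q : Dec (p ≡ q)) → All (CoeffShape b₁ M cap 0) (multiplySimpleWith c p d q p≟q)
    shape (yes refl) = (c * d , IsInt-* c∈ℤ d∈ℤ , sym (ℚₚ.*-identityʳ (c * d)) , below-cap p p≤hi₂ q≤hi₃) ∷ []
    shape (no p≢q)   =
      inj₁ (c * d * inv (fromℤ (q ℤ.- p)) ,
            DIntegral-*ˡ (IsInt-* c∈ℤ d∈ℤ) (DIntegral-inv (q ℤ.- p) M (i-j≢0 (λ q≡p → p≢q (sym q≡p))) ∣q-p∣≤) ,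
            sym (ℚₚ.*-identityʳ _)) ∷
      inj₁ (c * d * inv (fromℤ (p ℤ.- q)) ,
            DIntegral-*ˡ (IsInt-* c∈ℤ d∈ℤ) (DIntegral-inv (p ℤ.- q) M (i-j≢0 p≢q) (subst (ℕ._≤ M) (ℤₚ.∣i-j∣≡∣j-i∣ q p) ∣q-p∣≤)) ,
            sym (ℚₚ.*-identityʳ _)) ∷ []

  FinalShape : ℕ → ℤ → Term → Set
  FinalShape M cap (simple c k) = DIntegral M c
  FinalShape M cap (double c k) = IsInt c × k ℤ.< cap

  finalShape : ∀ b₁ M cap n₁ x → n₁ ℕ.≤ M → CoeffShape b₁ M cap n₁ x →
    FinalShape M cap (scaleTerm (inv (fromℤ (+ (n₁ !)))) x)
  finalShape b₁ M cap n₁ (simple c k) _ (inj₁ (β₀ , β₀∈ , refl)) =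
    subst (DIntegral M) (solve 3 (λ b p i → b :* (p :* i) := i :* (b :* p)) refl β₀ (poch (b₁ ℤ.- k) n₁) (inv (fromℤ (+ (n₁ !)))))
      (DIntegral-*ʳ (IsInt-poch/! (b₁ ℤ.- k) n₁) β₀∈)
  finalShape b₁ M cap .(suc (i ℕ.+ j)) (simple c k) n₁≤M (inj₂ (α₀ , i , j , α₀∈ℤ , refl , refl)) =
    subst (DIntegral M) eq
      (DIntegral-*ˡ (IsInt-* α₀∈ℤ (IsInt-* (IsInt-poch/! y i) (IsInt-poch/! z j))) (DIntegral-mono n₁≤M (i!j!/[i+j+1]!-DIntegral i j)))
    where
    y = b₁ ℤ.- k
    z = y ℤ.+ + suc i
    Fi = fromℤ (+ (i !))
    Fj = fromℤ (+ (j !))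
    iF = inv (fromℤ (+ (suc (i ℕ.+ j) !)))
    eq : α₀ * ((poch y i * inv Fi) * (poch z j * inv Fj)) * (Fi * Fj * iF) ≡ iF * (α₀ * (poch y i * poch z j))
    eq = begin
      α₀ * ((poch y i * inv Fi) * (poch z j * inv Fj)) * (Fi * Fj * iF)
          ≡⟨ solve 8 (λ a py ii pz ij fi fj iF → a :* ((py :* ii) :* (pz :* ij)) :* (fi :* fj :* iF) := iF :* (a :* (py :* pz)) :* (fi :* ii) :* (fj :* ij)) refl
                     α₀ (poch y i) (inv Fi) (poch z j) (inv Fj) Fi Fj iF ⟩
      iF * (α₀ * (poch y i * poch z j)) * (Fi * inv Fi) * (Fj * inv Fj)
          ≡⟨ cong₂ (λ u v → iF * (α₀ * (poch y i * poch z j)) * u * v) (fromℤ-inverseʳ (1≤⇒≢0 (ℤ.+≤+ (ℕₚ.1≤n! i)))) (fromℤ-inverseʳ (1≤⇒≢0 (ℤ.+≤+ (ℕₚ.1≤n! j)))) ⟩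
      iF * (α₀ * (poch y i * poch z j)) * 1ℚ * 1ℚ
          ≡⟨ solve 1 (λ w → w :* con 1ℚ :* con 1ℚ := w) refl (iF * (α₀ * (poch y i * poch z j))) ⟩
      iF * (α₀ * (poch y i * poch z j))   ∎
      where open ≡-Reasoning
  finalShape b₁ M cap n₁ (double c k) _ (α₀ , α₀∈ℤ , refl , k<cap) =
    subst IsInt (solve 3 (λ a p i → a :* (p :* i) := i :* (a :* p)) refl α₀ (poch (b₁ ℤ.- k) n₁) (inv (fromℤ (+ (n₁ !)))))
      (IsInt-* α₀∈ℤ (IsInt-poch/! (b₁ ℤ.- k) n₁)) , k<cap

  FinalBounds : ℕ → ℕ → ℤ → Term → Set
  FinalBounds M X a₀ x@(simple c k) = DIntegral M c × poleOffset a₀ x ℕ.≤ X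
  FinalBounds M X a₀ x@(double c k) = IsInt c × poleOffset a₀ x ℕ.≤ X × poleOffset a₀ x ℕ.≤ M

  IsInt-doubleCoeffSum : ∀ M X a₀ L → All (FinalBounds M X a₀) L → IsInt (doubleCoeffSum L)
  IsInt-doubleCoeffSum M X a₀ []               []                 = + 0 , refl
  IsInt-doubleCoeffSum M X a₀ (simple c k ∷ L) (_ ∷ L-ok)          =
    subst IsInt (sym (ℚₚ.+-identityˡ (doubleCoeffSum L))) (IsInt-doubleCoeffSum M X a₀ L L-ok)
  IsInt-doubleCoeffSum M X a₀ (double c k ∷ L) ((c∈ℤ , _) ∷ L-ok) = IsInt-+ c∈ℤ (IsInt-doubleCoeffSum M X a₀ L L-ok)

  IsInt-D*D*harmonicPart : ∀ M X a₀ x → FinalBounds M X a₀ x →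
    IsInt (fromℤ (+ (D X ℕ.* D M)) * harmonicPart x (poleOffset a₀ x ℕ.+ 0))
  IsInt-D*D*harmonicPart M X a₀ x@(simple c k) (D-integral Dc∈ℤ , m≤X) =
    subst IsInt eq (IsInt-* Dc∈ℤ (integral (DIntegral-H₁ m X (subst (ℕ._≤ X) (sym (ℕₚ.+-identityʳ _)) m≤X))))
    where
    m = poleOffset a₀ x ℕ.+ 0
    eq : fromℤ (+ D M) * c * (fromℤ (+ D X) * H₁ m) ≡ fromℤ (+ (D X ℕ.* D M)) * (0ℚ * ζ2partial m + c * H₁ m)
    eq = trans (solve 5 (λ dm c dx h₁ h₂ → dm :* c :* (dx :* h₁) := dx :* dm :* (con 0ℚ :* h₂ :+ c :* h₁)) refl
                        (fromℤ (+ D M)) c (fromℤ (+ D X)) (H₁ m) (ζ2partial m))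
               (cong (_* (0ℚ * ζ2partial m + c * H₁ m)) (sym (fromℤ-pos-* (D X) (D M))))
  IsInt-D*D*harmonicPart M X a₀ x@(double c k) (c∈ℤ , m≤X , m≤M) = subst IsInt eq (IsInt-* c∈ℤ DX*DM*ζ∈ℤ)
    where
    m = poleOffset a₀ x ℕ.+ 0
    DM = fromℤ (+ D M)
    DX = fromℤ (+ D X)
    Dm = fromℤ (+ D m)
    DM*Dm*ζ∈ℤ : IsInt (DM * (Dm * ζ2partial m))
    DM*Dm*ζ∈ℤ = IsInt-∣-scale (Dm * ζ2partial m) (D-mono-∣ (subst (ℕ._≤ M) (sym (ℕₚ.+-identityʳ _)) m≤M)) (D²-ζ2partial m)
    DX*DM*ζ∈ℤ : IsInt (DX * (DM * ζ2partial m))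
    DX*DM*ζ∈ℤ = IsInt-∣-scale (DM * ζ2partial m) (D-mono-∣ (subst (ℕ._≤ X) (sym (ℕₚ.+-identityʳ _)) m≤X))
      (subst IsInt (solve 3 (λ a b h → a :* (b :* h) := b :* (a :* h)) refl DM Dm (ζ2partial m)) DM*Dm*ζ∈ℤ)
    eq : c * (DX * (DM * ζ2partial m)) ≡ fromℤ (+ (D X ℕ.* D M)) * (c * ζ2partial m + 0ℚ * H₁ m)
    eq = trans (solve 5 (λ c dx dm h₂ h₁ → c :* (dx :* (dm :* h₂)) := dx :* dm :* (c :* h₂ :+ con 0ℚ :* h₁)) refl c DX DM (ζ2partial m) (H₁ m))
               (cong (_* (c * ζ2partial m + 0ℚ * H₁ m)) (sym (fromℤ-pos-* (D X) (D M))))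

  IsInt-D*D*shiftedHarmonic : ∀ M X a₀ L → All (FinalBounds M X a₀) L →
    IsInt (fromℤ (+ (D X ℕ.* D M)) * shiftedHarmonic a₀ L 0)
  IsInt-D*D*shiftedHarmonic M X a₀ []      []            = + 0 , sym (ℚₚ.*-zeroʳ (fromℤ (+ (D X ℕ.* D M))))
  IsInt-D*D*shiftedHarmonic M X a₀ (x ∷ L) (x-ok ∷ L-ok) =
    subst IsInt (sym (ℚₚ.*-distribˡ-+ (fromℤ (+ (D X ℕ.* D M))) _ (shiftedHarmonic a₀ L 0)))
      (IsInt-+ (IsInt-D*D*harmonicPart M X a₀ x x-ok) (IsInt-D*D*shiftedHarmonic M X a₀ L L-ok))

  ≤-+-shift : ∀ {x y} d {x′ y′} → x ℤ.≤ y → x ℤ.+ d ≡ x′ → y ℤ.+ d ≡ y′ → x′ ℤ.≤ y′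
  ≤-+-shift d x≤y refl refl = ℤₚ.+-monoˡ-≤ d x≤y

  sub-mono-≤ : ∀ {i j k l} → i ℤ.≤ j → k ℤ.≤ l → i ℤ.- l ℤ.≤ j ℤ.- k
  sub-mono-≤ i≤j k≤l = ℤₚ.+-mono-≤ i≤j (ℤₚ.neg-mono-≤ k≤l)

  -[i-j]≡j-i : ∀ i j → ℤ.- (i ℤ.- j) ≡ j ℤ.- i
  -[i-j]≡j-i = ℤ-Solver.solve-∀

  ≤-1⇒< : ∀ {p b} → p ℤ.≤ b ℤ.- + 1 → p ℤ.< b
  ≤-1⇒< {p} {b} p≤b-1 = ℤₚ.i≤pred[j]⇒i<j (subst (p ℤ.≤_) (ℤₚ.+-comm b ℤ.-1ℤ) p≤b-1)

  <⇒≤-1 : ∀ {p b} → p ℤ.< b → p ℤ.≤ b ℤ.- + 1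
  <⇒≤-1 {p} {b} p<b = subst (p ℤ.≤_) (ℤₚ.+-comm ℤ.-1ℤ b) (ℤₚ.i<j⇒i≤pred[j] p<b)

  [x-1]-a≡x-a-1 : ∀ x a → (x ℤ.- + 1) ℤ.- a ≡ x ℤ.- a ℤ.- + 1
  [x-1]-a≡x-a-1 = ℤ-Solver.solve-∀

  <⇒0≤-1 : ∀ {a b} → a ℤ.< b → + 0 ℤ.≤ b ℤ.- a ℤ.- + 1
  <⇒0≤-1 {a} {b} a<b = ≤-+-shift (ℤ.- a) (<⇒≤-1 a<b) (ℤₚ.+-inverseʳ a) ([x-1]-a≡x-a-1 b a)

  ≤⇒[·-1]-a≤ : ∀ {b B} a → b ℤ.≤ B → (b ℤ.- + 1) ℤ.- a ℤ.≤ B ℤ.- a ℤ.- + 1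
  ≤⇒[·-1]-a≤ {b} {B} a b≤B =
    subst ((b ℤ.- + 1) ℤ.- a ℤ.≤_) ([x-1]-a≡x-a-1 B a) (ℤₚ.+-monoˡ-≤ (ℤ.- a) (ℤₚ.+-monoˡ-≤ (ℤ.- + 1) b≤B))

  toℕ-mono-≤ : ∀ {n w} → + n ℤ.≤ w → n ℕ.≤ toℕ w
  toℕ-mono-≤ (ℤ.+≤+ n≤m) = n≤m

  ∣∣≤toℕ : ∀ {z W} → z ℤ.≤ W → ℤ.- z ℤ.≤ W → ℤ.∣ z ∣ ℕ.≤ toℕ W
  ∣∣≤toℕ {+ n}      z≤W  _    = toℕ-mono-≤ z≤W
  ∣∣≤toℕ { -[1+ n ]} _   -z≤W = toℕ-mono-≤ -z≤W

  ∣k-a∣≤toℕ : ∀ {a k W} → a ℤ.≤ k → k ℤ.- a ℤ.≤ W → ℤ.∣ k ℤ.- a ∣ ℕ.≤ toℕ W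
  ∣k-a∣≤toℕ {a} {k} a≤k k-a≤W = ∣∣≤toℕ k-a≤W
    (ℤₚ.≤-trans (ℤₚ.neg-mono-≤ (ℤₚ.i≤j⇒0≤j-i a≤k)) (ℤₚ.≤-trans (ℤₚ.i≤j⇒0≤j-i a≤k) k-a≤W))

  toℕ≡suc : ∀ z → + 0 ℤ.≤ z ℤ.- + 1 → toℕ z ≡ suc (toℕ (z ℤ.- + 1))
  toℕ≡suc z 0≤z-1 = begin
    toℕ z                                  ≡⟨ cong toℕ (sym (trans (cong (ℤ._+ + 1) (ℤₚ.0≤i⇒+∣i∣≡i 0≤z-1)) (cancel z))) ⟩
    toℕ (+ toℕ (z ℤ.- + 1) ℤ.+ + 1)        ≡⟨ cong toℕ (sym (ℤₚ.pos-+ (toℕ (z ℤ.- + 1)) 1)) ⟩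
    toℕ (z ℤ.- + 1) ℕ.+ 1                  ≡⟨ ℕₚ.+-comm _ 1 ⟩
    suc (toℕ (z ℤ.- + 1))                  ∎
    where
    open ≡-Reasoning
    cancel : ∀ z → (z ℤ.- + 1) ℤ.+ + 1 ≡ z
    cancel = ℤ-Solver.solve-∀

  module Hypotheses (a₁ a₂ a₃ b₁ b₂ b₃ : ℤ)
    (b₁≤a₀ : b₁ ℤ.≤ (a₁ ⊓ a₂) ⊓ a₃)
    (aₘₐₓ<c : (a₁ ⊔ a₂) ⊔ a₃ ℤ.< b₂ ⊓ b₃)
    (Σa≤Σb-2 : a₁ ℤ.+ a₂ ℤ.+ a₃ ℤ.≤ b₁ ℤ.+ b₂ ℤ.+ b₃ ℤ.- + 2) where

    a₀ c C : ℤ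
    a₀ = (a₁ ⊓ a₂) ⊓ a₃
    c = b₂ ⊓ b₃
    C = b₂ ⊔ b₃

    n₁ n₂ n₃ : ℕ
    n₁ = toℕ (a₁ ℤ.- b₁)
    n₂ = toℕ (b₂ ℤ.- a₂ ℤ.- + 1)
    n₃ = toℕ (b₃ ℤ.- a₃ ℤ.- + 1)

    Mℤ : ℤ
    Mℤ = (((a₁ ℤ.- b₁) ⊔ (C ℤ.- a₂ ℤ.- + 1)) ⊔ (C ℤ.- a₃ ℤ.- + 1)) ⊔ (c ℤ.- a₀ ℤ.- + 1)

    X M : ℕ
    X = toℕ (C ℤ.- a₀ ℤ.- + 1)
    M = toℕ Mℤ

    a₀≤a₁ : a₀ ℤ.≤ a₁
    a₀≤a₁ = ℤₚ.≤-trans (ℤₚ.i⊓j≤i (a₁ ⊓ a₂) a₃) (ℤₚ.i⊓j≤i a₁ a₂)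
    a₀≤a₂ : a₀ ℤ.≤ a₂
    a₀≤a₂ = ℤₚ.≤-trans (ℤₚ.i⊓j≤i (a₁ ⊓ a₂) a₃) (ℤₚ.i⊓j≤j a₁ a₂)
    a₀≤a₃ : a₀ ℤ.≤ a₃
    a₀≤a₃ = ℤₚ.i⊓j≤j (a₁ ⊓ a₂) a₃

    a₂<b₂ : a₂ ℤ.< b₂
    a₂<b₂ = ℤₚ.≤-<-trans (ℤₚ.≤-trans (ℤₚ.i≤j⊔i a₁ a₂) (ℤₚ.i≤i⊔j (a₁ ⊔ a₂) a₃)) (ℤₚ.<-≤-trans aₘₐₓ<c (ℤₚ.i⊓j≤i b₂ b₃))
    a₃<b₃ : a₃ ℤ.< b₃
    a₃<b₃ = ℤₚ.≤-<-trans (ℤₚ.i≤j⊔i (a₁ ⊔ a₂) a₃) (ℤₚ.<-≤-trans aₘₐₓ<c (ℤₚ.i⊓j≤j b₂ b₃))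

    +n₁≡a₁-b₁ : + n₁ ≡ a₁ ℤ.- b₁
    +n₁≡a₁-b₁ = ℤₚ.0≤i⇒+∣i∣≡i (ℤₚ.i≤j⇒0≤j-i (ℤₚ.≤-trans b₁≤a₀ a₀≤a₁))
    +n₂≡b₂-a₂-1 : + n₂ ≡ b₂ ℤ.- a₂ ℤ.- + 1
    +n₂≡b₂-a₂-1 = ℤₚ.0≤i⇒+∣i∣≡i (<⇒0≤-1 a₂<b₂)
    +n₃≡b₃-a₃-1 : + n₃ ≡ b₃ ℤ.- a₃ ℤ.- + 1
    +n₃≡b₃-a₃-1 = ℤₚ.0≤i⇒+∣i∣≡i (<⇒0≤-1 a₃<b₃)

    a+[b-a-1]≡b-1 : ∀ a b → a ℤ.+ (b ℤ.- a ℤ.- + 1) ≡ b ℤ.- + 1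
    a+[b-a-1]≡b-1 = ℤ-Solver.solve-∀

    a₂+n₂≡b₂-1 : a₂ ℤ.+ + n₂ ≡ b₂ ℤ.- + 1
    a₂+n₂≡b₂-1 = trans (cong (ℤ._+_ a₂) +n₂≡b₂-a₂-1) (a+[b-a-1]≡b-1 a₂ b₂)
    a₃+n₃≡b₃-1 : a₃ ℤ.+ + n₃ ≡ b₃ ℤ.- + 1
    a₃+n₃≡b₃-1 = trans (cong (ℤ._+_ a₃) +n₃≡b₃-a₃-1) (a+[b-a-1]≡b-1 a₃ b₃)

    n₁≤n₂+n₃ : n₁ ℕ.≤ n₂ ℕ.+ n₃
    n₁≤n₂+n₃ = toℕ-mono-≤ (subst₂ ℤ._≤_ (sym +n₁≡a₁-b₁) (trans (cong₂ ℤ._+_ (sym +n₂≡b₂-a₂-1) (sym +n₃≡b₃-a₃-1)) (sym (ℤₚ.pos-+ n₂ n₃)))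
      (≤-+-shift (ℤ.- (b₁ ℤ.+ a₂ ℤ.+ a₃)) Σa≤Σb-2 (left a₁ a₂ a₃ b₁) (right a₂ a₃ b₁ b₂ b₃)))
      where
      left : ∀ a₁ a₂ a₃ b₁ → (a₁ ℤ.+ a₂ ℤ.+ a₃) ℤ.+ ℤ.- (b₁ ℤ.+ a₂ ℤ.+ a₃) ≡ a₁ ℤ.- b₁
      left = ℤ-Solver.solve-∀
      right : ∀ a₂ a₃ b₁ b₂ b₃ → (b₁ ℤ.+ b₂ ℤ.+ b₃ ℤ.- + 2) ℤ.+ ℤ.- (b₁ ℤ.+ a₂ ℤ.+ a₃)
                               ≡ (b₂ ℤ.- a₂ ℤ.- + 1) ℤ.+ (b₃ ℤ.- a₃ ℤ.- + 1)
      right = ℤ-Solver.solve-∀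

    a₁-b₁≤M : a₁ ℤ.- b₁ ℤ.≤ Mℤ
    a₁-b₁≤M = ℤₚ.i≤j⇒i≤j⊔k _ (ℤₚ.i≤j⇒i≤j⊔k _ (ℤₚ.i≤i⊔j _ _))
    C-a₂-1≤M : C ℤ.- a₂ ℤ.- + 1 ℤ.≤ Mℤ
    C-a₂-1≤M = ℤₚ.i≤j⇒i≤j⊔k _ (ℤₚ.i≤j⇒i≤j⊔k _ (ℤₚ.i≤j⊔i _ _))
    C-a₃-1≤M : C ℤ.- a₃ ℤ.- + 1 ℤ.≤ Mℤ
    C-a₃-1≤M = ℤₚ.i≤j⇒i≤j⊔k _ (ℤₚ.i≤j⊔i _ _)
    c-a₀-1≤M : c ℤ.- a₀ ℤ.- + 1 ℤ.≤ Mℤ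
    c-a₀-1≤M = ℤₚ.i≤j⊔i _ _

    n₁≤M : n₁ ℕ.≤ M
    n₁≤M = toℕ-mono-≤ (subst (ℤ._≤ Mℤ) (sym +n₁≡a₁-b₁) a₁-b₁≤M)

    PoleInRange : ℤ → Set
    PoleInRange k = a₀ ℤ.≤ k × k ℤ.≤ C ℤ.- + 1

    pole₂-range : ∀ p → a₂ ℤ.≤ p → p ℤ.≤ a₂ ℤ.+ + n₂ → PoleInRange p
    pole₂-range p a₂≤p p≤a₂+n₂ =
      ℤₚ.≤-trans a₀≤a₂ a₂≤p , ℤₚ.≤-trans (subst (p ℤ.≤_) a₂+n₂≡b₂-1 p≤a₂+n₂) (ℤₚ.+-monoˡ-≤ (ℤ.- + 1) (ℤₚ.i≤i⊔j b₂ b₃))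
    pole₃-range : ∀ q → a₃ ℤ.≤ q → q ℤ.≤ a₃ ℤ.+ + n₃ → PoleInRange q
    pole₃-range q a₃≤q q≤a₃+n₃ =
      ℤₚ.≤-trans a₀≤a₃ a₃≤q , ℤₚ.≤-trans (subst (q ℤ.≤_) a₃+n₃≡b₃-1 q≤a₃+n₃) (ℤₚ.+-monoˡ-≤ (ℤ.- + 1) (ℤₚ.i≤j⊔i b₂ b₃))

    offset≤X : ∀ k → PoleInRange k → ℤ.∣ k ℤ.- a₀ ∣ ℕ.≤ X
    offset≤X k (a₀≤k , k≤C-1) = ∣k-a∣≤toℕ a₀≤k (subst (k ℤ.- a₀ ℤ.≤_) ([x-1]-a≡x-a-1 C a₀) (ℤₚ.+-monoˡ-≤ (ℤ.- a₀) k≤C-1))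

    offset≤M : ∀ k → a₀ ℤ.≤ k → k ℤ.< c → ℤ.∣ k ℤ.- a₀ ∣ ℕ.≤ M
    offset≤M k a₀≤k k<c = ∣k-a∣≤toℕ a₀≤k
      (ℤₚ.≤-trans (subst (k ℤ.- a₀ ℤ.≤_) ([x-1]-a≡x-a-1 c a₀) (ℤₚ.+-monoˡ-≤ (ℤ.- a₀) (<⇒≤-1 k<c))) c-a₀-1≤M)

    pole-distance≤M : ∀ p q → a₂ ℤ.≤ p → p ℤ.≤ a₂ ℤ.+ + n₂ → a₃ ℤ.≤ q → q ℤ.≤ a₃ ℤ.+ + n₃ → ℤ.∣ q ℤ.- p ∣ ℕ.≤ M
    pole-distance≤M p q a₂≤p p≤a₂+n₂ a₃≤q q≤a₃+n₃ = ∣∣≤toℕ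
      (ℤₚ.≤-trans (ℤₚ.≤-trans (sub-mono-≤ (subst (q ℤ.≤_) a₃+n₃≡b₃-1 q≤a₃+n₃) a₂≤p) (≤⇒[·-1]-a≤ a₂ (ℤₚ.i≤j⊔i b₂ b₃))) C-a₂-1≤M)
      (subst (ℤ._≤ Mℤ) (sym (-[i-j]≡j-i q p))
        (ℤₚ.≤-trans (ℤₚ.≤-trans (sub-mono-≤ (subst (p ℤ.≤_) a₂+n₂≡b₂-1 p≤a₂+n₂) a₃≤q) (≤⇒[·-1]-a≤ a₃ (ℤₚ.i≤i⊔j b₂ b₃))) C-a₃-1≤M))

    common-pole<c : ∀ p → p ℤ.≤ a₂ ℤ.+ + n₂ → p ℤ.≤ a₃ ℤ.+ + n₃ → p ℤ.< c
    common-pole<c p p≤a₂+n₂ p≤a₃+n₃ = ℤₚ.suc[i]≤j⇒i<j (ℤₚ.⊓-glb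
      (ℤₚ.i<j⇒suc[i]≤j (≤-1⇒< (subst (p ℤ.≤_) a₂+n₂≡b₂-1 p≤a₂+n₂)))
      (ℤₚ.i<j⇒suc[i]≤j (≤-1⇒< (subst (p ℤ.≤_) a₃+n₃≡b₃-1 p≤a₃+n₃))))

    Φ : ℤ → ℚ
    Φ t = pochReciprocal a₂ n₂ t * pochReciprocal a₃ n₃ t

    L₀ : List Term
    L₀ = multiplyFractions (pochFractions n₂ a₂) (pochFractions n₃ a₃)

    stage : ℕ → List Term
    stage = mulPoch b₁ L₀

    L : List Term
    L = scaleTerms (inv (fromℤ (+ (n₁ !)))) (stage n₁)

    L₀-poles : All (λ x → PoleInRange (pole x)) L₀
    L₀-poles = multiplyFractions-All
      (λ x y (_ , a₂≤p , p≤) (_ , a₃≤q , q≤) → multiplySimple-poles PoleInRange x y (pole₂-range _ a₂≤p p≤) (pole₃-range _ a₃≤q q≤))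
      (pochFractions n₂ a₂) (pochFractions n₃ a₃) (pochFractions-All n₂ a₂) (pochFractions-All n₃ a₃)

    stage-poles : ∀ s → All (λ x → PoleInRange (pole x)) (stage s)
    stage-poles s = mulPoch-poles PoleInRange b₁ L₀ s L₀-poles

    L-poles : All (λ x → PoleInRange (pole x)) L
    L-poles = scaleTerms-poles PoleInRange _ (stage n₁) (stage-poles n₁)

    poles-beyond : ∀ N {K} → All (λ x → PoleInRange (pole x)) K → All (λ x → + suc N ℤ.≤ τ a₀ N ℤ.+ pole x) K
    poles-beyond N = All.map (λ {x} in-range → 1+N≤τ+a a₀ (pole x) N (proj₁ in-range))

    poles-positive : ∀ N {K} → All (λ x → PoleInRange (pole x)) K → All (λ x → + 1 ℤ.≤ τ a₀ N ℤ.+ pole x) K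
    poles-positive N = All.map (λ {x} in-range → 1≤τ+a a₀ (pole x) N (proj₁ in-range))

    L₀-eval : ∀ N → evalTerms (τ a₀ N) L₀ ≡ Φ (τ a₀ N)
    L₀-eval N = trans (multiplyFractions-eval t (pochFractions n₂ a₂) (pochFractions n₃ a₃) positive₂ positive₃)
      (cong₂ _*_ (pochFractions-eval n₂ a₂ t (1≤τ+a a₀ a₂ N a₀≤a₂)) (pochFractions-eval n₃ a₃ t (1≤τ+a a₀ a₃ N a₀≤a₃)))
      where
      t = τ a₀ N
      positive₂ : All (λ x → + 1 ℤ.≤ t ℤ.+ proj₂ x) (pochFractions n₂ a₂)
      positive₂ = All.map (λ {x} (_ , a₂≤k , _) → 1≤τ+a a₀ (proj₂ x) N (ℤₚ.≤-trans a₀≤a₂ a₂≤k)) (pochFractions-All n₂ a₂)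
      positive₃ : All (λ x → + 1 ℤ.≤ t ℤ.+ proj₂ x) (pochFractions n₃ a₃)
      positive₃ = All.map (λ {x} (_ , a₃≤k , _) → 1≤τ+a a₀ (proj₂ x) N (ℤₚ.≤-trans a₀≤a₃ a₃≤k)) (pochFractions-All n₃ a₃)

    stage-eval : ∀ s N → (∀ r → r ℕ.< s → residueSum (stage r) ≡ 0ℚ) →
      evalTerms (τ a₀ N) (stage s) ≡ poch (τ a₀ N ℤ.+ b₁) s * Φ (τ a₀ N)
    stage-eval s N earlier≡0 =
      trans (mulPoch-eval (τ a₀ N) b₁ L₀ s (poles-positive N L₀-poles) earlier≡0) (cong (poch (τ a₀ N ℤ.+ b₁) s *_) (L₀-eval N))

    -- For s ≤ n₁, (t + b₁)ₛ Φ(t) has degree at most -2, so t times it is O(1/N); so is its difference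
    -- with the residue sum, which therefore vanishes.
    residueSum-stage≡0 : ∀ s → s ℕ.≤ n₁ → residueSum (stage s) ≡ 0ℚ
    residueSum-stage≡0 = <-rec (λ s → s ℕ.≤ n₁ → residueSum (stage s) ≡ 0ℚ)
      λ s earlier s≤n₁ → residueSum-vanishes s s≤n₁ (λ r r<s → earlier r<s (ℕₚ.≤-trans (ℕₚ.<⇒≤ r<s) s≤n₁))
      where
      residueSum-vanishes : ∀ s → s ℕ.≤ n₁ → (∀ r → r ℕ.< s → residueSum (stage r) ≡ 0ℚ) → residueSum (stage s) ≡ 0ℚ
      residueSum-vanishes s s≤n₁ earlier≡0 = ≤C/[1+N]⇒≡0 β (termsBound (stage s) + K) (0≤+ (termsBound-nonNeg (stage s)) (fromℤ-nonNeg (decayConstant a₀ b₁ n₂ n₃ s))) bound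
        where
        β = residueSum (stage s)
        K = fromℤ (+ decayConstant a₀ b₁ n₂ n₃ s)
        bound : ∀ N → ∣ β ∣ ≤ (termsBound (stage s) + K) * 1/[1+ N ]
        bound N = begin
          ∣ β ∣                    ≡⟨ cong ∣_∣ (solve 2 (λ e b → b := e :- (e :- b)) refl tE β) ⟩
          ∣ tE - (tE - β) ∣        ≤⟨ ℚₚ.∣p-q∣≤∣p∣+∣q∣ tE (tE - β) ⟩
          ∣ tE ∣ + ∣ tE - β ∣      ≤⟨ ℚₚ.+-mono-≤ ∣tE∣≤ (t*evalTerms-residueSum-bound t N (stage s) (poles-beyond N (stage-poles s))) ⟩
          K * 1/[1+ N ] + termsBound (stage s) * 1/[1+ N ]
              ≡⟨ solve 3 (λ a b i → a :* i :+ b :* i := (b :+ a) :* i) refl K (termsBound (stage s)) 1/[1+ N ] ⟩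
          (termsBound (stage s) + K) * 1/[1+ N ]   ∎
          where
          open ℚₚ.≤-Reasoning
          t = τ a₀ N
          tE = fromℤ t * evalTerms t (stage s)
          ∣tE∣≤ : ∣ tE ∣ ≤ K * 1/[1+ N ]
          ∣tE∣≤ = subst (λ w → ∣ fromℤ t * w ∣ ≤ K * 1/[1+ N ]) (sym (stage-eval s N earlier≡0))
                        (τ*stage-bound a₀ b₁ a₂ a₃ n₂ n₃ s N a₀≤a₂ a₀≤a₃ (ℕₚ.≤-trans s≤n₁ n₁≤n₂+n₃))

    R-at : ℤ → ℚ
    R-at = R a₁ a₂ a₃ b₁ b₂ b₃

    R≡evalTerms : ∀ N → R-at (τ a₀ N) ≡ evalTerms (τ a₀ N) L
    R≡evalTerms N = begin
      R-at t
          ≡⟨ cong₂ (λ u v → ((F₂ * F₃) * iF) * (P * (inv (poch (t ℤ.+ a₂) u) * inv (poch (t ℤ.+ a₃) v))))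
                   (toℕ≡suc (b₂ ℤ.- a₂) (<⇒0≤-1 a₂<b₂)) (toℕ≡suc (b₃ ℤ.- a₃) (<⇒0≤-1 a₃<b₃)) ⟩
      ((F₂ * F₃) * iF) * (P * (inv (poch (t ℤ.+ a₂) (suc n₂)) * inv (poch (t ℤ.+ a₃) (suc n₃))))
          ≡⟨ solve 6 (λ F₂ F₃ iF P i₂ i₃ → ((F₂ :* F₃) :* iF) :* (P :* (i₂ :* i₃)) := iF :* (P :* ((F₂ :* i₂) :* (F₃ :* i₃)))) refl
                     F₂ F₃ iF P (inv (poch (t ℤ.+ a₂) (suc n₂))) (inv (poch (t ℤ.+ a₃) (suc n₃))) ⟩
      iF * (P * Φ t)
          ≡⟨ cong (iF *_) (sym (stage-eval n₁ N (λ r r<n₁ → residueSum-stage≡0 r (ℕₚ.<⇒≤ r<n₁)))) ⟩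
      iF * evalTerms t (stage n₁)
          ≡⟨ sym (evalTerms-scale t iF (stage n₁)) ⟩
      evalTerms t L   ∎
      where
      open ≡-Reasoning
      t = τ a₀ N
      F₂ = fromℤ (+ (n₂ !))
      F₃ = fromℤ (+ (n₃ !))
      iF = inv (fromℤ (+ (n₁ !)))
      P = poch (t ℤ.+ b₁) n₁

    L₀-shape : All (CoeffShape b₁ M c 0) L₀
    L₀-shape = multiplyFractions-All (multiplySimple-shape b₁ M c a₂ (a₂ ℤ.+ + n₂) a₃ (a₃ ℤ.+ + n₃) pole-distance≤M common-pole<c)
      (pochFractions n₂ a₂) (pochFractions n₃ a₃) (pochFractions-All n₂ a₂) (pochFractions-All n₃ a₃)

    L-shape : All (FinalShape M c) L
    L-shape = Allₚ.map⁺ (All.map (λ {x} → finalShape b₁ M c n₁ x n₁≤M)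
      (mulPoch-All b₁ (mulLinearTerm-shape b₁ M c) L₀ n₁ L₀-shape))

    L-bounds : All (FinalBounds M X a₀) L
    L-bounds = All.zipWith bounds (L-shape , L-poles)
      where
      bounds : ∀ {x} → FinalShape M c x × PoleInRange (pole x) → FinalBounds M X a₀ x
      bounds {simple _ k} (c∈ , in-range)         = c∈ , offset≤X k in-range
      bounds {double _ k} ((c∈ℤ , k<c) , in-range) = c∈ℤ , offset≤X k in-range , offset≤M k (proj₁ in-range) k<c

    A : ℤ
    A = proj₁ (IsInt-doubleCoeffSum M X a₀ L L-bounds)

    B : ℚ
    B = shiftedHarmonic a₀ L 0

    B-integral : Σ ℤ λ z → fromℤ z ≡ fromℤ (+ (D X ℕ.* D M)) * B
    B-integral = IsInt-D*D*shiftedHarmonic M X a₀ L L-bounds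

    residueSum-L≡0 : residueSum L ≡ 0ℚ
    residueSum-L≡0 = trans (residueSum-scale 1/n₁! (stage n₁)) (trans (cong (1/n₁! *_) (residueSum-stage≡0 n₁ ℕₚ.≤-refl)) (ℚₚ.*-zeroʳ 1/n₁!))
      where 1/n₁! = inv (fromℤ (+ (n₁ !)))

    T : ℤ
    T = + 1 ℤ.- a₀

    Gpartial-T≡ : ∀ N → (Gpartial a₁ a₂ a₃ b₁ b₂ b₃ T N - fromℤ A * ζ2partial N) - (- B) ≡ harmonicDefect a₀ L N
    Gpartial-T≡ N = begin
      (Gpartial a₁ a₂ a₃ b₁ b₂ b₃ T N - fromℤ A * ζ2partial N) - (- B)
          ≡⟨ cong₂ (λ u v → (u - v * ζ2partial N) - (- B)) G≡SH (proj₂ (IsInt-doubleCoeffSum M X a₀ L L-bounds)) ⟩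
      ((SH N - B) - doubleCoeffSum L * ζ2partial N) - (- B)
          ≡⟨ cong (λ w → ((w - B) - doubleCoeffSum L * ζ2partial N) - (- B)) (shiftedHarmonic-split a₀ L N) ⟩
      ((DH + (doubleCoeffSum L * ζ2partial N + residueSum L * H₁ N)) - B - doubleCoeffSum L * ζ2partial N) - (- B)
          ≡⟨ cong (λ w → ((DH + (doubleCoeffSum L * ζ2partial N + w * H₁ N)) - B - doubleCoeffSum L * ζ2partial N) - (- B)) residueSum-L≡0 ⟩
      ((DH + (doubleCoeffSum L * ζ2partial N + 0ℚ * H₁ N)) - B - doubleCoeffSum L * ζ2partial N) - (- B)
          ≡⟨ solve 5 (λ d a h h₁ b → ((d :+ (a :* h :+ con 0ℚ :* h₁)) :- b :- a :* h) :- (:- b) := d) refl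
                     DH (doubleCoeffSum L) (ζ2partial N) (H₁ N) B ⟩
      DH   ∎
      where
      open ≡-Reasoning
      SH = shiftedHarmonic a₀ L
      DH = harmonicDefect a₀ L N
      G≡SH : Gpartial a₁ a₂ a₃ b₁ b₂ b₃ T N ≡ SH N - B
      G≡SH = trans (sumℚ-cong N (λ k → R≡evalTerms k)) (sumTerms-τ a₀ N L (All.map proj₁ L-poles))

    -- 1/Γ(t + b₁) vanishes for t + b₁ ≤ 0: the factor (t + b₁)ₙ₁ passes through 0 before reaching t + a₁.
    R-vanishes : ∀ k → τ a₀ k ℤ.+ b₁ ℤ.≤ + 0 → R-at (τ a₀ k) ≡ 0ℚ
    R-vanishes k t+b₁≤0 = begin
      K * (poch (t ℤ.+ b₁) n₁ * Y)               ≡⟨ cong (λ w → K * (w * Y)) (trans (poch≡fromℤ-pochℤ (t ℤ.+ b₁) n₁) (cong fromℤ pochℤ≡0)) ⟩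
      K * (0ℚ * Y)                               ≡⟨ solve 2 (λ K Y → K :* (con 0ℚ :* Y) := con 0ℚ) refl K Y ⟩
      0ℚ                                         ∎
      where
      open ≡-Reasoning
      t = τ a₀ k
      K = (facℚ (b₂ ℤ.- a₂ ℤ.- + 1) * facℚ (b₃ ℤ.- a₃ ℤ.- + 1)) * inv (fromℤ (+ (n₁ !)))
      Y = inv (poch (t ℤ.+ a₂) (toℕ (b₂ ℤ.- a₂))) * inv (poch (t ℤ.+ a₃) (toℕ (b₃ ℤ.- a₃)))
      regroup : ∀ t b₁ a₁ → (t ℤ.+ b₁) ℤ.+ (a₁ ℤ.- b₁) ≡ t ℤ.+ a₁
      regroup = ℤ-Solver.solve-∀
      pochℤ≡0 : pochℤ (t ℤ.+ b₁) n₁ ≡ + 0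
      pochℤ≡0 = pochℤ-zero (t ℤ.+ b₁) n₁ t+b₁≤0
        (subst (+ 1 ℤ.≤_) (sym (trans (cong (ℤ._+_ (t ℤ.+ b₁)) +n₁≡a₁-b₁) (regroup t b₁ a₁))) (1≤τ+a a₀ a₁ k a₀≤a₁))

    τ+b₁≤0 : ∀ {k d} → k ℕ.< d → τ a₀ d ℤ.≤ + 1 ℤ.- b₁ → τ a₀ k ℤ.+ b₁ ℤ.≤ + 0
    τ+b₁≤0 {k} {d} k<d τ≤1-b₁ = ≤-+-shift (b₁ ℤ.- + 1) (ℤₚ.≤-trans (ℤₚ.+-monoʳ-≤ (+ 1 ℤ.- a₀) (ℤ.+≤+ k<d)) τ≤1-b₁)
      (trans (cong (λ w → ((+ 1 ℤ.- a₀) ℤ.+ w) ℤ.+ (b₁ ℤ.- + 1)) (ℤₚ.pos-+ 1 k)) (left a₀ b₁ (+ k))) (right b₁)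
      where
      left : ∀ a₀ b₁ k → ((+ 1 ℤ.- a₀) ℤ.+ (+ 1 ℤ.+ k)) ℤ.+ (b₁ ℤ.- + 1) ≡ ((+ 1 ℤ.- a₀) ℤ.+ k) ℤ.+ b₁
      left = ℤ-Solver.solve-∀
      right : ∀ b₁ → (+ 1 ℤ.- b₁) ℤ.+ (b₁ ℤ.- + 1) ≡ + 0
      right = ℤ-Solver.solve-∀

    Gpartial-shift : ∀ d N → τ a₀ d ℤ.≤ + 1 ℤ.- b₁ →
      Gpartial a₁ a₂ a₃ b₁ b₂ b₃ (τ a₀ d) N ≡ Gpartial a₁ a₂ a₃ b₁ b₂ b₃ T (d ℕ.+ N)
    Gpartial-shift d N τ≤1-b₁ = begin
      sumℚ N (λ k → R-at (τ a₀ d ℤ.+ + k))     ≡⟨ sumℚ-cong N (λ k → cong R-at (trans (ℤₚ.+-assoc T (+ d) (+ k)) (cong (ℤ._+_ T) (sym (ℤₚ.pos-+ d k))))) ⟩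
      sumℚ N (λ k → f (d ℕ.+ k))               ≡⟨ sumℚ-shift f d N ⟩
      sumℚ (d ℕ.+ N) f - sumℚ d f              ≡⟨ cong (_-_ (sumℚ (d ℕ.+ N) f)) (sumℚ-vanishing d f (λ k k<d → R-vanishes k (τ+b₁≤0 k<d τ≤1-b₁))) ⟩
      sumℚ (d ℕ.+ N) f - 0ℚ                    ≡⟨ solve 1 (λ a → a :- con 0ℚ := a) refl (sumℚ (d ℕ.+ N) f) ⟩
      sumℚ (d ℕ.+ N) f                         ∎
      where
      open ≡-Reasoning
      f : ℕ → ℚ
      f k = R-at (T ℤ.+ + k)

    converges-from-τ : ∀ d → τ a₀ d ℤ.≤ + 1 ℤ.- b₁ →
      ConvergesTo (λ N → Gpartial a₁ a₂ a₃ b₁ b₂ b₃ (τ a₀ d) N - fromℤ A * ζ2partial N) (- B)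
    converges-from-τ d τ≤1-b₁ = ≤C/[1+N]⇒ConvergesTo (λ N → Gpartial a₁ a₂ a₃ b₁ b₂ b₃ (τ a₀ d) N - fromℤ A * ζ2partial N) (- B) Cst 0≤Cst bound
      where
      Aq = fromℤ A
      DB = defectBound a₀ L
      Cst = DB + ∣ Aq ∣ * fromℤ (+ d)
      0≤Cst : 0ℚ ≤ Cst
      0≤Cst = 0≤+ (defectBound-nonNeg a₀ L) (0≤* (ℚₚ.0≤∣p∣ Aq) (fromℤ-nonNeg d))
      bound : ∀ N → ∣ (Gpartial a₁ a₂ a₃ b₁ b₂ b₃ (τ a₀ d) N - Aq * ζ2partial N) - (- B) ∣ ≤ Cst * 1/[1+ N ]
      bound N = begin
        ∣ (Gpartial a₁ a₂ a₃ b₁ b₂ b₃ (τ a₀ d) N - Aq * ζ2partial N) - (- B) ∣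
            ≡⟨ cong (λ w → ∣ (w - Aq * ζ2partial N) - (- B) ∣) (Gpartial-shift d N τ≤1-b₁) ⟩
        ∣ (G - Aq * ζ2partial N) - (- B) ∣
            ≡⟨ cong ∣_∣ (solve 5 (λ g a h h′ b → (g :- a :* h) :- (:- b) := ((g :- a :* h′) :- (:- b)) :+ a :* (h′ :- h)) refl
                               G Aq (ζ2partial N) (ζ2partial (d ℕ.+ N)) B) ⟩
        ∣ ((G - Aq * ζ2partial (d ℕ.+ N)) - (- B)) + Aq * (ζ2partial (d ℕ.+ N) - ζ2partial N) ∣
            ≤⟨ ℚₚ.∣p+q∣≤∣p∣+∣q∣ ((G - Aq * ζ2partial (d ℕ.+ N)) - (- B)) (Aq * (ζ2partial (d ℕ.+ N) - ζ2partial N)) ⟩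
        ∣ (G - Aq * ζ2partial (d ℕ.+ N)) - (- B) ∣ + ∣ Aq * (ζ2partial (d ℕ.+ N) - ζ2partial N) ∣
            ≡⟨ cong₂ _+_ (cong ∣_∣ (Gpartial-T≡ (d ℕ.+ N))) (ℚₚ.∣p*q∣≡∣p∣*∣q∣ Aq _) ⟩
        ∣ harmonicDefect a₀ L (d ℕ.+ N) ∣ + ∣ Aq ∣ * ∣ ζ2partial (d ℕ.+ N) - ζ2partial N ∣
            ≤⟨ ℚₚ.+-mono-≤ (ℚₚ.≤-trans (∣harmonicDefect∣≤ a₀ L (d ℕ.+ N)) (*-monoˡ-≤-0≤ DB (defectBound-nonNeg a₀ L) (1/[1+]-antimono (ℕₚ.m≤n+m N d))))
                           (*-monoˡ-≤-0≤ ∣ Aq ∣ (ℚₚ.0≤∣p∣ Aq) (∣ζ2partial-tail∣≤ d N)) ⟩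
        DB * 1/[1+ N ] + ∣ Aq ∣ * (fromℤ (+ d) * 1/[1+ N ])
            ≡⟨ solve 4 (λ c a d i → c :* i :+ a :* (d :* i) := (c :+ a :* d) :* i) refl DB ∣ Aq ∣ (fromℤ (+ d)) 1/[1+ N ] ⟩
        Cst * 1/[1+ N ]   ∎
        where
        open ℚₚ.≤-Reasoning
        G = Gpartial a₁ a₂ a₃ b₁ b₂ b₃ T (d ℕ.+ N)

    converges : ∀ t₀ → T ℤ.≤ t₀ → t₀ ℤ.≤ + 1 ℤ.- b₁ →
      ConvergesTo (λ N → Gpartial a₁ a₂ a₃ b₁ b₂ b₃ t₀ N - fromℤ A * ζ2partial N) (- B)
    converges t₀ T≤t₀ t₀≤1-b₁ = subst (λ w → ConvergesTo (λ N → Gpartial a₁ a₂ a₃ b₁ b₂ b₃ w N - fromℤ A * ζ2partial N) (- B))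
      τ≡t₀ (converges-from-τ d (subst (ℤ._≤ + 1 ℤ.- b₁) (sym τ≡t₀) t₀≤1-b₁))
      where
      d = toℕ (t₀ ℤ.- T)
      cancel : ∀ T t → T ℤ.+ (t ℤ.- T) ≡ t
      cancel = ℤ-Solver.solve-∀
      τ≡t₀ : τ a₀ d ≡ t₀
      τ≡t₀ = trans (cong (ℤ._+_ T) (ℤₚ.0≤i⇒+∣i∣≡i (ℤₚ.i≤j⇒0≤j-i T≤t₀))) (cancel T t₀)

open import Defs
open import Data.Nat using (ℕ)
open import Data.Integer using (ℤ; +_; _≤_; _<_; _⊓_; _⊔_; _+_; _-_)
open import Data.Rational using (ℚ; _*_)
import Data.Rational as ℚ
open import Data.Product using (Σ; _×_; _,_)
open import Relation.Binary.PropositionalEquality using (_≡_)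

lemma13 : (a₁ a₂ a₃ b₁ b₂ b₃ : ℤ) →
  b₁ ≤ (a₁ ⊓ a₂) ⊓ a₃ →
  (a₁ ⊔ a₂) ⊔ a₃ < b₂ ⊓ b₃ →
  a₁ + a₂ + a₃ ≤ b₁ + b₂ + b₃ - + 2 →
  Σ ℤ (λ A → Σ ℚ (λ B →
    ((t₀ : ℤ) → + 1 - ((a₁ ⊓ a₂) ⊓ a₃) ≤ t₀ → t₀ ≤ + 1 - b₁ →
      ConvergesTo (λ N → Gpartial a₁ a₂ a₃ b₁ b₂ b₃ t₀ N ℚ.- fromℤ A * ζ2partial N)
                  (ℚ.- B))
    × Σ ℤ (λ z → fromℤ z ≡
        fromℤ (+ (D (toℕ ((b₂ ⊔ b₃) - ((a₁ ⊓ a₂) ⊓ a₃) - + 1))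
                 Data.Nat.* D (toℕ ((((a₁ - b₁) ⊔ ((b₂ ⊔ b₃) - a₂ - + 1))
                                      ⊔ ((b₂ ⊔ b₃) - a₃ - + 1))
                                      ⊔ ((b₂ ⊓ b₃) - ((a₁ ⊓ a₂) ⊓ a₃) - + 1)))))
        * B)))
lemma13 a₁ a₂ a₃ b₁ b₂ b₃ b₁≤a₀ aₘₐₓ<c Σa≤Σb-2 = A , B , converges , B-integral
  where open Proof.Hypotheses a₁ a₂ a₃ b₁ b₂ b₃ b₁≤a₀ aₘₐₓ<c Σa≤Σb-2
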